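{- Let $M=\{\{1,2\},\{3,5\},\{4,6\}\}$ and $N=\{\{1,3\},\{2,4\},\{5,6\}\}$. For every $k,n\in\mathbb{N}$, the number of matchings on $[2n]$ with exactly $k$ crossings in which the last three edges form a matching order-isomorphic to $M$ equals the number of matchings on $[2n]$ with exactly $k$ crossings in which the last three edges form a matching order-isomorphic to $N$.
   Context: A matching on $[2n]$ is a partition of $[2n]$ into two-element blocks (edges). Edges are ordered by their smaller elements; the last three edges are the three edges with the largest smaller elements, and they form a matching order-isomorphic to $M$ if relabeling their six vertices order-preservingly by $1,\dots,6$ yields $M$. Two distinct edges $A,B$ cross if $\min A<\min B<\max A<\max B$ or vice versa; the number of crossings of a matching is the number of crossing pairs of edges. -}

module Defs where

open import Data.Nat using (ℕ; zero; suc; _*_; _<ᵇ_; _≡ᵇ_)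
open import Data.Bool using (Bool; true; false; _∧_; _∨_; not)
open import Data.Fin using (Fin; toℕ)
open import Data.Vec using (Vec; []; _∷_; lookup)
open import Data.List using (List; []; _∷_; map; concatMap; allFin; filterᵇ; length)
open import Data.Bool.ListAction using (all; any)

-- A matching on [2n] is represented by its partner map: the vertex set is
-- Fin (2 * n) (vertex i stands for i+1 in [2n]), and a vector p : Vec (Fin (2 * n)) (2 * n)
-- sends each vertex to the other endpoint of its edge.  Such a vector is a matching
-- iff p is a fixed-point-free involution; this is a bijective encoding of
-- partitions of [2n] into two-element blocks.

allVecs : (m k : ℕ) → List (Vec (Fin m) k)
allVecs m zero = [] ∷ []
allVecs m (suc k) = concatMap (λ x → map (x ∷_) (allVecs m k)) (allFin m)

module _ {m : ℕ} (p : Vec (Fin m) m) where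

  partner : Fin m → ℕ
  partner i = toℕ (lookup p i)

  isMatching : Bool
  isMatching = all (λ i → not (toℕ (lookup p i) ≡ᵇ toℕ i)
                        ∧ (toℕ (lookup p (lookup p i)) ≡ᵇ toℕ i)) (allFin m)

  opener : Fin m → Bool
  opener i = toℕ i <ᵇ partner i

  crossesAt : Fin m → Fin m → Bool
  crossesAt i j = opener i ∧ opener j ∧ (toℕ i <ᵇ toℕ j)
                  ∧ (toℕ j <ᵇ partner i) ∧ (partner i <ᵇ partner j)

  -- number of crossing pairs of edges (each unordered pair counted once, via i < j)
  crossings : ℕ
  crossings = length (filterᵇ (λ ij → crossesAt (Data.Product.proj₁ ij) (Data.Product.proj₂ ij))
                (Data.List.cartesianProduct (allFin m) (allFin m)))
    where import Data.Product

  -- the edges with smaller elements a < b < c are exactly the last three edges: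
  -- a, b, c are openers and every opener x with a ≤ x is one of a, b, c
  lastThreeAt : Fin m → Fin m → Fin m → Bool
  lastThreeAt a b c = opener a ∧ opener b ∧ opener c
                      ∧ (toℕ a <ᵇ toℕ b) ∧ (toℕ b <ᵇ toℕ c)
                      ∧ all (λ x → not (opener x) ∨ (toℕ x <ᵇ toℕ a)
                                    ∨ (toℕ x ≡ᵇ toℕ a) ∨ (toℕ x ≡ᵇ toℕ b) ∨ (toℕ x ≡ᵇ toℕ c))
                            (allFin m)

  -- The three edges A={a,a'}, B={b,b'}, C={c,c'} with a<b<c, a<a', b<b', c<c'
  -- are order-isomorphic to M = {{1,2},{3,5},{4,6}} iff relabelling gives
  -- a↦1, a'↦2, b↦3, c↦4, b'↦5, c'↦6, i.e. a < a' < b < c < b' < c'.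
  patternM : Fin m → Fin m → Fin m → Bool
  patternM a b c = (partner a <ᵇ toℕ b) ∧ (toℕ b <ᵇ toℕ c)
                   ∧ (toℕ c <ᵇ partner b) ∧ (partner b <ᵇ partner c)
                   ∧ (toℕ a <ᵇ partner a)

  -- ... order-isomorphic to N = {{1,3},{2,4},{5,6}} iff
  -- a↦1, b↦2, a'↦3, b'↦4, c↦5, c'↦6, i.e. a < b < a' < b' < c < c'.
  patternN : Fin m → Fin m → Fin m → Bool
  patternN a b c = (toℕ a <ᵇ toℕ b) ∧ (toℕ b <ᵇ partner a)
                   ∧ (partner a <ᵇ partner b) ∧ (partner b <ᵇ toℕ c)
                   ∧ (toℕ c <ᵇ partner c)

  lastThreeForm : (Fin m → Fin m → Fin m → Bool) → Bool
  lastThreeForm pat = any (λ a → any (λ b → any (λ c → lastThreeAt a b c ∧ pat a b c)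
                                          (allFin m)) (allFin m)) (allFin m)

countWith : (Pat : {m : ℕ} → Vec (Fin m) m → Fin m → Fin m → Fin m → Bool) → ℕ → ℕ → ℕ
countWith Pat k n =
  length (filterᵇ (λ p → isMatching p ∧ (crossings p ≡ᵇ k) ∧ lastThreeForm p (Pat p))
                  (allVecs (2 * n) (2 * n)))

countM : ℕ → ℕ → ℕ
countM = countWith patternM

countN : ℕ → ℕ → ℕ
countN = countWith patternN

-- From the opener a of its third-to-last edge on, a matching of shape M reads
--   a [n₁] a′ [n₂] b [n₃] c [n₄] b′ [n₅] c′
-- and one of shape N reads
--   a [n₁] b [n₄] a′ [n₃] b′ [n₂] c [n₅] c′,
-- where [k] is a block of k closers of edges opened before a: every other vertex from a on
-- is such a closer.  Rearranging the six vertices of the last three edges between these two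
-- forms, with the closers kept in their order, exchanges the two kinds of matchings.  It keeps
-- the number of crossings: the last three edges cross each other once in both forms, a closer
-- in the blocks n₁, n₂, n₃, n₄, n₅ crosses 1, 0, 1, 2, 1 of them in both forms, and all other
-- pairs of edges keep their relative order.  The rearrangement is a composite of swaps of
-- adjacent vertices, each of which changes the crossing number by exactly one.

module Submission where

open import Defs
open import Data.Nat using (ℕ; _*_)
open import Relation.Binary.PropositionalEquality using (_≡_)

module Crossings where

  open import Function using (id; _∘_)
  open import Data.Nat
  open import Data.Nat.Properties
  open import Data.Nat.Tactic.RingSolver using (solve-∀)
  open import Data.Bool using (Bool; true; false; _∧_; if_then_else_; T)
  open import Data.Empty using (⊥-elim)
  open import Data.Sum using (_⊎_; inj₁; inj₂)
  open import Data.Product using (_×_; _,_; proj₁; proj₂)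
  open import Relation.Nullary using (¬_; Dec; yes; no)
  open import Relation.Binary.Definitions using (tri<; tri≈; tri>)
  open import Relation.Binary.PropositionalEquality

  <⇒<ᵇ≡true : ∀ {m n} → m < n → (m <ᵇ n) ≡ true
  <⇒<ᵇ≡true {m} {n} m<n with m <ᵇ n | <⇒<ᵇ m<n
  ... | true | _ = refl

  ≥⇒<ᵇ≡false : ∀ {m n} → n ≤ m → (m <ᵇ n) ≡ false
  ≥⇒<ᵇ≡false {m} {n} n≤m with m <ᵇ n in eq
  ... | false = refl
  ... | true  = ⊥-elim (<⇒≱ (<ᵇ⇒< m n (subst T (sym eq) _)) n≤m)

  <ᵇ≡true⇒< : ∀ {m n} → (m <ᵇ n) ≡ true → m < n
  <ᵇ≡true⇒< {m} {n} eq = <ᵇ⇒< m n (subst T (sym eq) _)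

  n<ᵇn≡false : ∀ n → (n <ᵇ n) ≡ false
  n<ᵇn≡false n = ≥⇒<ᵇ≡false {n} ≤-refl

  𝟙 : Bool → ℕ
  𝟙 b = if b then 1 else 0

  ∑ : ℕ → (ℕ → ℕ) → ℕ
  ∑ zero    f = 0
  ∑ (suc n) f = f 0 + ∑ n (f ∘ suc)

  ∑-cong : ∀ n {f g : ℕ → ℕ} → (∀ {i} → i < n → f i ≡ g i) → ∑ n f ≡ ∑ n g
  ∑-cong zero    eq = refl
  ∑-cong (suc n) eq = cong₂ _+_ (eq z<s) (∑-cong n (eq ∘ s<s))

  ∑-update : ∀ n {f g : ℕ → ℕ} {u} → u < n → (∀ {i} → i < n → i ≢ u → f i ≡ g i) →
             ∑ n f + g u ≡ ∑ n g + f u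
  ∑-update (suc n) {f} {g} {zero} _ eq
    rewrite ∑-cong n {f ∘ suc} {g ∘ suc} (λ i<n → eq (s<s i<n) λ ())
    = exchange (f 0) (∑ n (g ∘ suc)) (g 0)
    where
    exchange : ∀ a s b → a + s + b ≡ b + s + a
    exchange = solve-∀
  ∑-update (suc n) {f} {g} {suc u} (s<s u<n) eq = begin
    f 0 + ∑ n (f ∘ suc) + g (suc u)   ≡⟨ +-assoc (f 0) _ _ ⟩
    f 0 + (∑ n (f ∘ suc) + g (suc u)) ≡⟨ cong₂ _+_ (eq z<s λ ()) (∑-update n u<n λ i<n i≢u → eq (s<s i<n) (i≢u ∘ suc-injective)) ⟩
    g 0 + (∑ n (g ∘ suc) + f (suc u)) ≡⟨ +-assoc (g 0) _ _ ⟨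
    g 0 + ∑ n (g ∘ suc) + f (suc u)   ∎
    where open ≡-Reasoning

  private
    ∑-update₂-at-0 : ∀ n {f g : ℕ → ℕ} {w} → w < n →
                     (∀ {i} → i < suc n → i ≢ 0 → i ≢ suc w → f i ≡ g i) →
                     ∑ (suc n) f + (g 0 + g (suc w)) ≡ ∑ (suc n) g + (f 0 + f (suc w))
    ∑-update₂-at-0 n {f} {g} {w} w<n eq = begin
      f 0 + ∑ n (f ∘ suc) + (g 0 + g (suc w))   ≡⟨ shuffle (f 0) (g 0) _ _ ⟩
      f 0 + g 0 + (∑ n (f ∘ suc) + g (suc w))   ≡⟨ cong (f 0 + g 0 +_) rest ⟩
      f 0 + g 0 + (∑ n (g ∘ suc) + f (suc w))   ≡⟨ cong (_+ (∑ n (g ∘ suc) + f (suc w))) (+-comm (f 0) (g 0)) ⟩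
      g 0 + f 0 + (∑ n (g ∘ suc) + f (suc w))   ≡⟨ shuffle (g 0) (f 0) _ _ ⟨
      g 0 + ∑ n (g ∘ suc) + (f 0 + f (suc w))   ∎
      where
      open ≡-Reasoning
      shuffle : ∀ a b s c → a + s + (b + c) ≡ a + b + (s + c)
      shuffle = solve-∀
      rest : ∑ n (f ∘ suc) + g (suc w) ≡ ∑ n (g ∘ suc) + f (suc w)
      rest = ∑-update n w<n λ i<n i≢w → eq (s<s i<n) (λ ()) (i≢w ∘ suc-injective)

  ∑-update₂ : ∀ n {f g : ℕ → ℕ} {u w} → u ≢ w → u < n → w < n →
              (∀ {i} → i < n → i ≢ u → i ≢ w → f i ≡ g i) →
              ∑ n f + (g u + g w) ≡ ∑ n g + (f u + f w)
  ∑-update₂ (suc n) {u = zero}  {zero}  u≢w _ _ eq = ⊥-elim (u≢w refl)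
  ∑-update₂ (suc n) {u = zero}  {suc w} _ _ (s<s w<n) eq = ∑-update₂-at-0 n w<n eq
  ∑-update₂ (suc n) {f} {g} {suc u} {zero} _ (s<s u<n) _ eq = begin
    ∑ (suc n) f + (g (suc u) + g 0) ≡⟨ cong (∑ (suc n) f +_) (+-comm (g (suc u)) (g 0)) ⟩
    ∑ (suc n) f + (g 0 + g (suc u)) ≡⟨ ∑-update₂-at-0 n u<n (λ i<n i≢0 i≢u → eq i<n i≢u i≢0) ⟩
    ∑ (suc n) g + (f 0 + f (suc u)) ≡⟨ cong (∑ (suc n) g +_) (+-comm (f 0) (f (suc u))) ⟩
    ∑ (suc n) g + (f (suc u) + f 0) ∎
    where open ≡-Reasoning
  ∑-update₂ (suc n) {f} {g} {suc u} {suc w} u≢w (s<s u<n) (s<s w<n) eq = begin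
    f 0 + ∑ n (f ∘ suc) + (g (suc u) + g (suc w))   ≡⟨ +-assoc (f 0) _ _ ⟩
    f 0 + (∑ n (f ∘ suc) + (g (suc u) + g (suc w))) ≡⟨ cong₂ _+_ (eq z<s (λ ()) (λ ())) rest ⟩
    g 0 + (∑ n (g ∘ suc) + (f (suc u) + f (suc w))) ≡⟨ +-assoc (g 0) _ _ ⟨
    g 0 + ∑ n (g ∘ suc) + (f (suc u) + f (suc w))   ∎
    where
    open ≡-Reasoning
    rest = ∑-update₂ n (u≢w ∘ cong suc) u<n w<n
             λ i<n i≢u i≢w → eq (s<s i<n) (i≢u ∘ suc-injective) (i≢w ∘ suc-injective)

  ∑∑ : ℕ → (ℕ → ℕ → ℕ) → ℕ
  ∑∑ n g = ∑ n (λ i → ∑ n (g i))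

  ∑∑-update₂ : ∀ n {g h : ℕ → ℕ → ℕ} {e f} → e ≢ f → e < n → f < n →
               (∀ {i j} → i < n → j < n → (i , j) ≢ (e , f) → (i , j) ≢ (f , e) → g i j ≡ h i j) →
               ∑∑ n g + (h e f + h f e) ≡ ∑∑ n h + (g e f + g f e)
  ∑∑-update₂ n {g} {h} {e} {f} e≢f e<n f<n eq =
    combine (∑∑ n g) (∑∑ n h) (h e f) (h f e) (g e f) (g f e)
            (∑-update₂ n {λ i → ∑ n (g i)} {λ i → ∑ n (h i)} e≢f e<n f<n rows)
            (∑-update n {g e} {h e} f<n row-e) (∑-update n {g f} {h f} e<n row-f)
    where
    rows : ∀ {i} → i < n → i ≢ e → i ≢ f → ∑ n (g i) ≡ ∑ n (h i)
    rows i<n i≢e i≢f = ∑-cong n λ j<n → eq i<n j<n (i≢e ∘ cong proj₁) (i≢f ∘ cong proj₁)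
    row-e : ∀ {j} → j < n → j ≢ f → g e j ≡ h e j
    row-e j<n j≢f = eq e<n j<n (j≢f ∘ cong proj₂) (e≢f ∘ cong proj₁)
    row-f : ∀ {j} → j < n → j ≢ e → g f j ≡ h f j
    row-f j<n j≢e = eq f<n j<n (e≢f ∘ sym ∘ cong proj₁) (j≢e ∘ cong proj₂)
    combine : ∀ x y a b a′ b′ {c d p q} → x + (c + d) ≡ y + (p + q) → p + a ≡ c + a′ → q + b ≡ d + b′ →
              x + (a + b) ≡ y + (a′ + b′)
    combine x y a b a′ b′ {c} {d} {p} {q} rows-eq e-eq f-eq = +-cancelʳ-≡ (c + d) _ _ (begin
      x + (a + b) + (c + d)     ≡⟨ r₁ x a b c d ⟩
      x + (c + d) + (a + b)     ≡⟨ cong (_+ (a + b)) rows-eq ⟩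
      y + (p + q) + (a + b)     ≡⟨ r₂ y p q a b ⟩
      y + (p + a + (q + b))     ≡⟨ cong (λ s → y + s) (cong₂ _+_ e-eq f-eq) ⟩
      y + (c + a′ + (d + b′))   ≡⟨ r₂ y c d a′ b′ ⟨
      y + (c + d) + (a′ + b′)   ≡⟨ r₁ y a′ b′ c d ⟨
      y + (a′ + b′) + (c + d)   ∎)
      where
      open ≡-Reasoning
      r₁ : ∀ x a b c d → x + (a + b) + (c + d) ≡ x + (c + d) + (a + b)
      r₁ = solve-∀
      r₂ : ∀ y p q a b → y + (p + q) + (a + b) ≡ y + (p + a + (q + b))
      r₂ = solve-∀

  τ : ℕ → ℕ → ℕ
  τ zero    zero          = 1
  τ zero    (suc zero)    = 0
  τ zero    (suc (suc y)) = suc (suc y)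
  τ (suc x) zero          = zero
  τ (suc x) (suc y)       = suc (τ x y)

  τ-involutive : ∀ x y → τ x (τ x y) ≡ y
  τ-involutive zero    zero          = refl
  τ-involutive zero    (suc zero)    = refl
  τ-involutive zero    (suc (suc y)) = refl
  τ-involutive (suc x) zero          = refl
  τ-involutive (suc x) (suc y)       = cong suc (τ-involutive x y)

  τ-left : ∀ x → τ x x ≡ suc x
  τ-left zero    = refl
  τ-left (suc x) = cong suc (τ-left x)

  τ-right : ∀ x → τ x (suc x) ≡ x
  τ-right zero    = refl
  τ-right (suc x) = cong suc (τ-right x)

  τ-below : ∀ x {y} → y < x → τ x y ≡ y
  τ-below (suc x) {zero}  _         = refl
  τ-below (suc x) {suc y} (s<s y<x) = cong suc (τ-below x y<x)

  τ-above : ∀ x {y} → suc x < y → τ x y ≡ y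
  τ-above zero    {suc zero}    (s<s ())
  τ-above zero    {suc (suc y)} _          = refl
  τ-above (suc x) {suc y}       (s<s x<y)  = cong suc (τ-above x x<y)

  τ-other : ∀ x {y} → y ≢ x → y ≢ suc x → τ x y ≡ y
  τ-other x {y} y≢x y≢1+x with <-cmp y x
  ... | tri< y<x _ _ = τ-below x y<x
  ... | tri≈ _ y≡x _ = ⊥-elim (y≢x y≡x)
  ... | tri> _ _ x<y with <-cmp y (suc x)
  ...   | tri< y<1+x _ _ = ⊥-elim (<⇒≱ x<y (s≤s⁻¹ y<1+x))
  ...   | tri≈ _ y≡1+x _ = ⊥-elim (y≢1+x y≡1+x)
  ...   | tri> _ _ 1+x<y = τ-above x 1+x<y

  τ-< : ∀ x {y m} → suc x < m → y < m → τ x y < m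
  τ-< x {y} 1+x<m y<m with y ≟ x | y ≟ suc x
  ... | yes refl | _        rewrite τ-left y = 1+x<m
  ... | no _     | yes refl rewrite τ-right x = <-trans (n<1+n x) 1+x<m
  ... | no y≢x   | no y≢1+x rewrite τ-other x y≢x y≢1+x = y<m

  ≤-τ : ∀ x {a y} → a ≤ x → a ≤ y → a ≤ τ x y
  ≤-τ x {a} {y} a≤x a≤y with y ≟ x | y ≟ suc x
  ... | yes refl | _        rewrite τ-left y = ≤-trans a≤y (n≤1+n y)
  ... | no _     | yes refl rewrite τ-right x = a≤x
  ... | no y≢x   | no y≢1+x rewrite τ-other x y≢x y≢1+x = a≤y

  ∑-τ : ∀ x n f → suc x < n → ∑ n (f ∘ τ x) ≡ ∑ n f
  ∑-τ zero    (suc (suc n)) f _ = begin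
    f 1 + (f 0 + r) ≡⟨ +-assoc (f 1) (f 0) r ⟨
    f 1 + f 0 + r   ≡⟨ cong (_+ r) (+-comm (f 1) (f 0)) ⟩
    f 0 + f 1 + r   ≡⟨ +-assoc (f 0) (f 1) r ⟩
    f 0 + (f 1 + r) ∎
    where
    open ≡-Reasoning
    r = ∑ n (f ∘ suc ∘ suc)
  ∑-τ zero    (suc zero)    f (s<s ())
  ∑-τ (suc x) (suc n) f (s<s 1+x<n) = cong (f 0 +_) (∑-τ x n (f ∘ suc) 1+x<n)

  IsSwapPair : ℕ → ℕ → ℕ → Set
  IsSwapPair x u v = (u ≡ x × v ≡ suc x) ⊎ (u ≡ suc x × v ≡ x)

  τ-preserves-<ᵇ : ∀ x u v → ¬ IsSwapPair x u v → (τ x u <ᵇ τ x v) ≡ (u <ᵇ v)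
  τ-preserves-<ᵇ zero    zero          zero          _  = refl
  τ-preserves-<ᵇ zero    zero          (suc zero)    ¬s = ⊥-elim (¬s (inj₁ (refl , refl)))
  τ-preserves-<ᵇ zero    zero          (suc (suc v)) _  = refl
  τ-preserves-<ᵇ zero    (suc zero)    zero          ¬s = ⊥-elim (¬s (inj₂ (refl , refl)))
  τ-preserves-<ᵇ zero    (suc zero)    (suc zero)    _  = refl
  τ-preserves-<ᵇ zero    (suc zero)    (suc (suc v)) _  = refl
  τ-preserves-<ᵇ zero    (suc (suc u)) zero          _  = refl
  τ-preserves-<ᵇ zero    (suc (suc u)) (suc zero)    _  = refl
  τ-preserves-<ᵇ zero    (suc (suc u)) (suc (suc v)) _  = refl
  τ-preserves-<ᵇ (suc x) zero          zero          _  = refl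
  τ-preserves-<ᵇ (suc x) zero          (suc v)       _  = refl
  τ-preserves-<ᵇ (suc x) (suc u)       zero          _  = refl
  τ-preserves-<ᵇ (suc x) (suc u)       (suc v)       ¬s = τ-preserves-<ᵇ x u v λ where
    (inj₁ (u≡x , v≡1+x)) → ¬s (inj₁ (cong suc u≡x , cong suc v≡1+x))
    (inj₂ (u≡1+x , v≡x)) → ¬s (inj₂ (cong suc u≡1+x , cong suc v≡x))

  -- The crossings of a partner function P after relabelling the vertices by σ; a crossing
  -- pair of edges is counted once, at its openers i < j.

  crossesUnder : (ℕ → ℕ) → (ℕ → ℕ) → ℕ → ℕ → Bool
  crossesUnder σ P i j = (σ i <ᵇ σ (P i)) ∧ (σ j <ᵇ σ (P j)) ∧ (σ i <ᵇ σ j)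
                         ∧ (σ j <ᵇ σ (P i)) ∧ (σ (P i) <ᵇ σ (P j))

  crosses : (ℕ → ℕ) → ℕ → ℕ → Bool
  crosses = crossesUnder id

  crossingNumberUnder : (ℕ → ℕ) → ℕ → (ℕ → ℕ) → ℕ
  crossingNumberUnder σ m P = ∑∑ m (λ i j → 𝟙 (crossesUnder σ P i j))

  crossingNumber : ℕ → (ℕ → ℕ) → ℕ
  crossingNumber = crossingNumberUnder id

  crossingNumber-cong : ∀ m {P Q : ℕ → ℕ} → (∀ {i} → i < m → P i ≡ Q i) → crossingNumber m P ≡ crossingNumber m Q
  crossingNumber-cong m {P} {Q} P≗Q = ∑-cong m λ i<m → ∑-cong m λ j<m → cong 𝟙 (same i<m j<m)
    where
    same : ∀ {i j} → i < m → j < m → crosses P i j ≡ crosses Q i j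
    same i<m j<m rewrite P≗Q i<m | P≗Q j<m = refl

  swapPartners : ℕ → (ℕ → ℕ) → ℕ → ℕ
  swapPartners x P = τ x ∘ P ∘ τ x

  crossingNumber-swapPartners : ∀ x m P → suc x < m →
                                crossingNumber m (swapPartners x P) ≡ crossingNumberUnder (τ x) m P
  crossingNumber-swapPartners x m P 1+x<m = begin
    ∑ m (λ i → ∑ m (λ j → 𝟙 (crosses Q i j)))                 ≡⟨ ∑-τ x m _ 1+x<m ⟨
    ∑ m (λ i → ∑ m (λ j → 𝟙 (crosses Q (τ x i) j)))           ≡⟨ ∑-cong m (λ _ → ∑-τ x m _ 1+x<m) ⟨
    ∑ m (λ i → ∑ m (λ j → 𝟙 (crosses Q (τ x i) (τ x j))))     ≡⟨ ∑-cong m (λ _ → ∑-cong m λ _ → cong 𝟙 (relabel _ _)) ⟩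
    crossingNumberUnder (τ x) m P                              ∎
    where
    open ≡-Reasoning
    Q = swapPartners x P
    relabel : ∀ i j → crosses Q (τ x i) (τ x j) ≡ crossesUnder (τ x) P i j
    relabel i j rewrite τ-involutive x i | τ-involutive x j = refl

  SwapSite : ℕ → ℕ → Set
  SwapSite x u = u ≡ x ⊎ u ≡ suc x

  swapSite? : ∀ x u → Dec (SwapSite x u)
  swapSite? x u with u ≟ x | u ≟ suc x
  ... | yes u≡x | _          = yes (inj₁ u≡x)
  ... | no _    | yes u≡1+x  = yes (inj₂ u≡1+x)
  ... | no u≢x  | no u≢1+x   = no λ where (inj₁ u≡x) → u≢x u≡x ; (inj₂ u≡1+x) → u≢1+x u≡1+x

  Touches : ℕ → (ℕ → ℕ) → ℕ → Set
  Touches x P i = SwapSite x i ⊎ SwapSite x (P i)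

  private
    swapPair-left : ∀ {x u v} → IsSwapPair x u v → SwapSite x u
    swapPair-left (inj₁ (u≡x , _))   = inj₁ u≡x
    swapPair-left (inj₂ (u≡1+x , _)) = inj₂ u≡1+x

    swapPair-right : ∀ {x u v} → IsSwapPair x u v → SwapSite x v
    swapPair-right (inj₁ (_ , v≡1+x)) = inj₂ v≡1+x
    swapPair-right (inj₂ (_ , v≡x))   = inj₁ v≡x

    ¬swapPair-edge : ∀ x (P : ℕ → ℕ) u → P x ≢ suc x → P (suc x) ≢ x → ¬ IsSwapPair x u (P u)
    ¬swapPair-edge x P u Px≢1+x _ (inj₁ (refl , Pu≡1+x)) = Px≢1+x Pu≡1+x
    ¬swapPair-edge x P u _ P1+x≢x (inj₂ (refl , Pu≡x))   = P1+x≢x Pu≡x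

  module _ (x : ℕ) (P : ℕ → ℕ) (Px≢1+x : P x ≢ suc x) (P1+x≢x : P (suc x) ≢ x) where

    private
      τ-edge : ∀ u → (τ x u <ᵇ τ x (P u)) ≡ (u <ᵇ P u)
      τ-edge u = τ-preserves-<ᵇ x u (P u) (¬swapPair-edge x P u Px≢1+x P1+x≢x)

      crossesUnder-τ-touching : ∀ i j → (Touches x P i → Touches x P j → i < P i → j < P j → i ≡ j) →
                                Touches x P i → Touches x P j → crossesUnder (τ x) P i j ≡ crosses P i j
      crossesUnder-τ-touching i j same ti tj rewrite τ-edge i | τ-edge j with i <ᵇ P i in oi
      ... | false = refl
      ... | true with j <ᵇ P j in oj
      ...   | false = refl
      ...   | true with i ≟ j
      ...     | yes refl rewrite n<ᵇn≡false i | n<ᵇn≡false (τ x i) = refl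
      ...     | no i≢j   = ⊥-elim (i≢j (same ti tj (<ᵇ≡true⇒< oi) (<ᵇ≡true⇒< oj)))

    -- Relabelling by τ x only affects comparisons between x and x + 1, so it can change
    -- the crossing status only of two distinct edges which both have an endpoint there.
    crossesUnder-τ : ∀ i j → (Touches x P i → Touches x P j → i < P i → j < P j → i ≡ j) →
                     crossesUnder (τ x) P i j ≡ crosses P i j
    crossesUnder-τ i j same with swapSite? x i | swapSite? x (P i) | swapSite? x j | swapSite? x (P j)
    ... | no ¬si | no ¬sPi | _ | _
      rewrite τ-edge i | τ-edge j
            | τ-preserves-<ᵇ x i j (¬si ∘ swapPair-left) | τ-preserves-<ᵇ x j (P i) (¬sPi ∘ swapPair-right)
            | τ-preserves-<ᵇ x (P i) (P j) (¬sPi ∘ swapPair-left) = refl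
    ... | _ | _ | no ¬sj | no ¬sPj
      rewrite τ-edge i | τ-edge j
            | τ-preserves-<ᵇ x i j (¬sj ∘ swapPair-right) | τ-preserves-<ᵇ x j (P i) (¬sj ∘ swapPair-left)
            | τ-preserves-<ᵇ x (P i) (P j) (¬sPj ∘ swapPair-right) = refl
    ... | yes si | _      | yes sj | _      = crossesUnder-τ-touching i j same (inj₁ si) (inj₁ sj)
    ... | yes si | _      | no _   | yes sPj = crossesUnder-τ-touching i j same (inj₁ si) (inj₂ sPj)
    ... | no _   | yes sPi | yes sj | _      = crossesUnder-τ-touching i j same (inj₂ sPi) (inj₁ sj)
    ... | no _   | yes sPi | no _   | yes sPj = crossesUnder-τ-touching i j same (inj₂ sPi) (inj₂ sPj)

    crossingNumber-swap : ∀ m {e f} → suc x < m → e ≢ f → e < m → f < m →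
      (∀ {k} → k < m → Touches x P k → k < P k → k ≡ e ⊎ k ≡ f) →
      crossingNumber m (swapPartners x P) + (𝟙 (crosses P e f) + 𝟙 (crosses P f e))
        ≡ crossingNumber m P + (𝟙 (crossesUnder (τ x) P e f) + 𝟙 (crossesUnder (τ x) P f e))
    crossingNumber-swap m {e} {f} 1+x<m e≢f e<m f<m touching rewrite crossingNumber-swapPartners x m P 1+x<m =
      ∑∑-update₂ m e≢f e<m f<m λ i<m j<m ij≢ef ij≢fe →
        cong 𝟙 (crossesUnder-τ _ _ (same i<m j<m ij≢ef ij≢fe))
      where
      same : ∀ {i j} → i < m → j < m → (i , j) ≢ (e , f) → (i , j) ≢ (f , e) →
             Touches x P i → Touches x P j → i < P i → j < P j → i ≡ j
      same {i} {j} i<m j<m ij≢ef ij≢fe ti tj oi oj with touching i<m ti oi | touching j<m tj oj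
      ... | inj₁ refl | inj₁ refl = refl
      ... | inj₁ refl | inj₂ refl = ⊥-elim (ij≢ef refl)
      ... | inj₂ refl | inj₁ refl = ⊥-elim (ij≢fe refl)
      ... | inj₂ refl | inj₂ refl = refl

  record IsMatching (m : ℕ) (P : ℕ → ℕ) : Set where
    field
      partner-<          : ∀ {y} → y < m → P y < m
      partner-≢          : ∀ {y} → y < m → P y ≢ y
      partner-involutive : ∀ {y} → y < m → P (P y) ≡ y

  open IsMatching public

  isMatching-swapPartners : ∀ x m P → suc x < m → IsMatching m P → IsMatching m (swapPartners x P)
  isMatching-swapPartners x m P 1+x<m M = record
    { partner-<          = λ y<m → τ-< x 1+x<m (partner-< M (τ-< x 1+x<m y<m))
    ; partner-≢          = λ {y} y<m eq → partner-≢ M (τ-< x 1+x<m y<m)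
                             (trans (sym (τ-involutive x (P (τ x y)))) (cong (τ x) eq))
    ; partner-involutive = λ {y} y<m → begin
        τ x (P (τ x (τ x (P (τ x y))))) ≡⟨ cong (τ x ∘ P) (τ-involutive x (P (τ x y))) ⟩
        τ x (P (P (τ x y)))             ≡⟨ cong (τ x) (partner-involutive M (τ-< x 1+x<m y<m)) ⟩
        τ x (τ x y)                     ≡⟨ τ-involutive x y ⟩
        y                               ∎
    }
    where open ≡-Reasoning

  isMatching-cong : ∀ m {P Q : ℕ → ℕ} → (∀ {y} → y < m → P y ≡ Q y) → IsMatching m P → IsMatching m Q
  isMatching-cong m {P} {Q} P≗Q M = record
    { partner-<          = λ y<m → subst (_< m) (P≗Q y<m) (partner-< M y<m)
    ; partner-≢          = λ y<m → subst (_≢ _) (P≗Q y<m) (partner-≢ M y<m)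
    ; partner-involutive = λ {y} y<m →
        trans (sym (trans (P≗Q (partner-< M y<m)) (cong Q (P≗Q y<m)))) (partner-involutive M y<m)
    }

  module _ {m} {P : ℕ → ℕ} (M : IsMatching m P) {x} (1+x<m : suc x < m) where

    private
      x<m = <-trans (n<1+n x) 1+x<m
      x<1+x = n<1+n x

      adjust : ∀ {s t a b c d} → s + a ≡ t + b → a ≡ c → b ≡ d → s + c ≡ t + d
      adjust eq refl refl = eq

      partner-of : ∀ {k y} → k < m → P k ≡ y → k ≡ P y
      partner-of k<m Pk≡y = trans (sym (partner-involutive M k<m)) (cong P Pk≡y)

    crossingNumber-swap-opener-closer : suc x < P x → P (suc x) < x →
                                        crossingNumber m (swapPartners x P) + 1 ≡ crossingNumber m P
    crossingNumber-swap-opener-closer 1+x<Px e<x =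
      trans (adjust (crossingNumber-swap x P (λ eq → <⇒≢ 1+x<Px (sym eq)) (<⇒≢ e<x) m 1+x<m
                       (<⇒≢ e<x) (<-trans e<x x<m) x<m touching) before after)
            (+-identityʳ _)
      where
      e = P (suc x)
      Pe≡1+x : P e ≡ suc x
      Pe≡1+x = partner-involutive M 1+x<m
      touching : ∀ {k} → k < m → Touches x P k → k < P k → k ≡ e ⊎ k ≡ x
      touching k<m (inj₁ (inj₁ refl)) _   = inj₂ refl
      touching k<m (inj₁ (inj₂ refl)) k<Pk = ⊥-elim (<-asym k<Pk (<-trans e<x x<1+x))
      touching {k} k<m (inj₂ (inj₁ Pk≡x)) k<Pk =
        ⊥-elim (<-asym (subst (_< P k) (partner-of k<m Pk≡x) k<Pk) (subst (_< P x) (sym Pk≡x) (<-trans x<1+x 1+x<Px)))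
      touching k<m (inj₂ (inj₂ Pk≡1+x)) _  = inj₁ (partner-of k<m Pk≡1+x)
      before : 𝟙 (crosses P e x) + 𝟙 (crosses P x e) ≡ 1
      before rewrite Pe≡1+x | <⇒<ᵇ≡true (<-trans e<x x<1+x) | <⇒<ᵇ≡true (<-trans x<1+x 1+x<Px) | <⇒<ᵇ≡true e<x
                   | <⇒<ᵇ≡true x<1+x | <⇒<ᵇ≡true 1+x<Px | ≥⇒<ᵇ≡false {x} {e} (<⇒≤ e<x) = refl
      after : 𝟙 (crossesUnder (τ x) P e x) + 𝟙 (crossesUnder (τ x) P x e) ≡ 0
      after rewrite Pe≡1+x | τ-below x e<x | τ-right x | τ-left x | τ-above x 1+x<Px | <⇒<ᵇ≡true e<x | <⇒<ᵇ≡true 1+x<Px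
                  | <⇒<ᵇ≡true (<-trans e<x x<1+x) | ≥⇒<ᵇ≡false {suc x} {x} (n≤1+n x)
                  | ≥⇒<ᵇ≡false {suc x} {e} (<⇒≤ (<-trans e<x x<1+x)) = refl

    crossingNumber-swap-closer-opener : P x < x → suc x < P (suc x) →
                                        crossingNumber m (swapPartners x P) ≡ crossingNumber m P + 1
    crossingNumber-swap-closer-opener e<x 1+x<P1+x =
      trans (sym (+-identityʳ _))
            (adjust (crossingNumber-swap x P (λ eq → <-asym (subst (_< x) eq e<x) x<1+x)
                       (λ eq → <⇒≢ (<-trans x<1+x 1+x<P1+x) (sym eq)) m 1+x<m
                       (<⇒≢ (<-trans e<x x<1+x)) (<-trans e<x x<m) 1+x<m touching) before after)
      where
      e = P x
      Pe≡x : P e ≡ x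
      Pe≡x = partner-involutive M x<m
      touching : ∀ {k} → k < m → Touches x P k → k < P k → k ≡ e ⊎ k ≡ suc x
      touching k<m (inj₁ (inj₁ refl)) k<Pk = ⊥-elim (<-asym k<Pk e<x)
      touching k<m (inj₁ (inj₂ refl)) _    = inj₂ refl
      touching k<m (inj₂ (inj₁ Pk≡x)) _    = inj₁ (partner-of k<m Pk≡x)
      touching {k} k<m (inj₂ (inj₂ Pk≡1+x)) k<Pk =
        ⊥-elim (<-asym (subst (_< P k) (partner-of k<m Pk≡1+x) k<Pk) (subst (_< P (suc x)) (sym Pk≡1+x) 1+x<P1+x))
      before : 𝟙 (crosses P e (suc x)) + 𝟙 (crosses P (suc x) e) ≡ 0
      before rewrite Pe≡x | <⇒<ᵇ≡true e<x | <⇒<ᵇ≡true 1+x<P1+x | <⇒<ᵇ≡true (<-trans e<x x<1+x)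
                   | ≥⇒<ᵇ≡false {suc x} {x} (n≤1+n x) | ≥⇒<ᵇ≡false {suc x} {e} (<⇒≤ (<-trans e<x x<1+x)) = refl
      after : 𝟙 (crossesUnder (τ x) P e (suc x)) + 𝟙 (crossesUnder (τ x) P (suc x) e) ≡ 1
      after rewrite Pe≡x | τ-below x e<x | τ-right x | τ-left x | τ-above x 1+x<P1+x | <⇒<ᵇ≡true e<x
                  | <⇒<ᵇ≡true 1+x<P1+x | <⇒<ᵇ≡true (<-trans e<x x<1+x) | <⇒<ᵇ≡true (<-trans x<1+x 1+x<P1+x)
                  | <⇒<ᵇ≡true x<1+x | ≥⇒<ᵇ≡false {x} {e} (<⇒≤ e<x) = refl

    module _ (Px<x : P x < x) (P1+x<x : P (suc x) < x) where

      private
        u = P x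
        v = P (suc x)
        Pu≡x : P u ≡ x
        Pu≡x = partner-involutive M x<m
        Pv≡1+x : P v ≡ suc x
        Pv≡1+x = partner-involutive M 1+x<m
        u<1+x = <-trans Px<x x<1+x
        v<1+x = <-trans P1+x<x x<1+x
        touching : ∀ {k} → k < m → Touches x P k → k < P k → k ≡ u ⊎ k ≡ v
        touching k<m (inj₁ (inj₁ refl)) k<Pk = ⊥-elim (<-asym k<Pk Px<x)
        touching k<m (inj₁ (inj₂ refl)) k<Pk = ⊥-elim (<-asym k<Pk v<1+x)
        touching k<m (inj₂ (inj₁ Pk≡x))   _  = inj₁ (partner-of k<m Pk≡x)
        touching k<m (inj₂ (inj₂ Pk≡1+x)) _  = inj₂ (partner-of k<m Pk≡1+x)
        swap : u ≢ v → crossingNumber m (swapPartners x P) + (𝟙 (crosses P u v) + 𝟙 (crosses P v u))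
                         ≡ crossingNumber m P + (𝟙 (crossesUnder (τ x) P u v) + 𝟙 (crossesUnder (τ x) P v u))
        swap u≢v = crossingNumber-swap x P (λ eq → <-asym (subst (_< x) eq Px<x) x<1+x) (λ eq → <-irrefl eq P1+x<x)
                     m 1+x<m u≢v (<-trans Px<x x<m) (<-trans P1+x<x x<m) touching

      crossingNumber-swap-closers-> : v < u → crossingNumber m (swapPartners x P) ≡ crossingNumber m P + 1
      crossingNumber-swap-closers-> v<u = trans (sym (+-identityʳ _)) (adjust (swap (<⇒≢ v<u ∘ sym)) before after)
        where
        before : 𝟙 (crosses P u v) + 𝟙 (crosses P v u) ≡ 0
        before rewrite Pu≡x | Pv≡1+x | <⇒<ᵇ≡true Px<x | <⇒<ᵇ≡true v<1+x | ≥⇒<ᵇ≡false {u} {v} (<⇒≤ v<u)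
                     | <⇒<ᵇ≡true v<u | <⇒<ᵇ≡true u<1+x | ≥⇒<ᵇ≡false {suc x} {x} (n≤1+n x) = refl
        after : 𝟙 (crossesUnder (τ x) P u v) + 𝟙 (crossesUnder (τ x) P v u) ≡ 1
        after rewrite Pu≡x | Pv≡1+x | τ-below x Px<x | τ-below x P1+x<x | τ-left x | τ-right x | <⇒<ᵇ≡true u<1+x
                    | <⇒<ᵇ≡true P1+x<x | ≥⇒<ᵇ≡false {u} {v} (<⇒≤ v<u) | <⇒<ᵇ≡true v<u | <⇒<ᵇ≡true Px<x
                    | <⇒<ᵇ≡true x<1+x = refl

      crossingNumber-swap-closers-< : u < v → crossingNumber m (swapPartners x P) + 1 ≡ crossingNumber m P
      crossingNumber-swap-closers-< u<v = trans (adjust (swap (<⇒≢ u<v)) before after) (+-identityʳ _)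
        where
        before : 𝟙 (crosses P u v) + 𝟙 (crosses P v u) ≡ 1
        before rewrite Pu≡x | Pv≡1+x | <⇒<ᵇ≡true Px<x | <⇒<ᵇ≡true v<1+x | <⇒<ᵇ≡true u<v | <⇒<ᵇ≡true P1+x<x
                     | <⇒<ᵇ≡true x<1+x | ≥⇒<ᵇ≡false {v} {u} (<⇒≤ u<v) = refl
        after : 𝟙 (crossesUnder (τ x) P u v) + 𝟙 (crossesUnder (τ x) P v u) ≡ 0
        after rewrite Pu≡x | Pv≡1+x | τ-below x Px<x | τ-below x P1+x<x | τ-left x | τ-right x | <⇒<ᵇ≡true u<1+x
                    | <⇒<ᵇ≡true P1+x<x | <⇒<ᵇ≡true u<v | <⇒<ᵇ≡true v<1+x | ≥⇒<ᵇ≡false {suc x} {x} (n≤1+n x)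
                    | ≥⇒<ᵇ≡false {v} {u} (<⇒≤ u<v) = refl

module VectorEncoding where

  open import Function using (_∘_; Equivalence; mk⇔)
  open import Data.Nat
  open import Data.Nat.Properties
  open import Data.Bool using (Bool; true; false; _∧_; not; T; T?)
  open import Data.Bool.Properties using (T-∧)
  open import Data.Bool.ListAction using (all; any)
  open import Data.Empty using (⊥-elim)
  open import Data.Product using (_×_; _,_; proj₁; proj₂; ∃)
  open import Data.Fin as Fin using (Fin; toℕ; fromℕ<)
  open import Data.Fin.Properties using (toℕ-injective; toℕ<n; fromℕ<-toℕ; toℕ-fromℕ<)
  open import Data.Vec using (Vec; []; _∷_; lookup; tabulate)
  open import Data.Vec.Properties using (lookup∘tabulate; tabulate∘lookup; tabulate-cong; ∷-injective)
  open import Data.List as List using (List; []; _∷_; _++_; map; concatMap; filterᵇ; length; allFin; cartesianProduct; cartesianProductWith)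
  import Data.List.Relation.Unary.All as All
  import Data.List.Relation.Unary.Any as Any
  open import Data.List.Relation.Unary.All.Properties using (all⁺; all⁻)
  open import Data.List.Relation.Unary.Any.Properties using (any⁺; any⁻)
  open import Data.List.Membership.Propositional using (_∈_; lose)
  open import Data.List.Membership.Propositional.Properties.WithK using (unique∧set⇒bag)
  import Data.List.Relation.Unary.AllPairs as AllPairs
  open import Data.List.Relation.Unary.Any using (here)
  open import Data.List.Relation.Unary.Unique.Propositional using (Unique)
  open import Data.List.Relation.Unary.Unique.Propositional.Properties using (map⁺; allFin⁺; cartesianProductWith⁺)
  open import Data.List.Relation.Binary.Permutation.Propositional using (_↭_)
  open import Data.List.Relation.Binary.Permutation.Propositional.Properties using (↭-length; filter-↭)
  open import Data.List.Relation.Binary.BagAndSetEquality using (∼bag⇒↭)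
  open import Data.List.Membership.Propositional.Properties using (∈-allFin; ∈-cartesianProductWith⁺; ∈-map⁺)
  open import Relation.Nullary using (yes; no)
  open import Relation.Binary.PropositionalEquality
  open Crossings

  all-allFin⁻ : ∀ {m} (p : Fin m → Bool) → T (all p (allFin m)) → ∀ i → T (p i)
  all-allFin⁻ p t i = All.lookup (all⁺ p _ t) (∈-allFin i)

  all-allFin⁺ : ∀ {m} (p : Fin m → Bool) → (∀ i → T (p i)) → T (all p (allFin m))
  all-allFin⁺ {m} p h = all⁻ p {allFin m} (All.tabulate λ {i} _ → h i)

  any-allFin⁻ : ∀ {m} (p : Fin m → Bool) → T (any p (allFin m)) → ∃ λ i → T (p i)
  any-allFin⁻ {m} p t = Any.satisfied (any⁻ p (allFin m) t)

  any-allFin⁺ : ∀ {m} (p : Fin m → Bool) i → T (p i) → T (any p (allFin m))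
  any-allFin⁺ p i t = any⁺ p (lose (∈-allFin i) t)

  count : ∀ {A : Set} → (A → Bool) → List A → ℕ
  count p xs = length (filterᵇ p xs)

  count-∷ : ∀ {A : Set} (p : A → Bool) x xs → count p (x ∷ xs) ≡ 𝟙 (p x) + count p xs
  count-∷ p x xs with p x
  ... | true  = refl
  ... | false = refl

  count-++ : ∀ {A : Set} (p : A → Bool) xs ys → count p (xs ++ ys) ≡ count p xs + count p ys
  count-++ p []       ys = refl
  count-++ p (x ∷ xs) ys rewrite count-∷ p x (xs ++ ys) | count-∷ p x xs | count-++ p xs ys =
    sym (+-assoc (𝟙 (p x)) _ _)

  count-map : ∀ {A B : Set} (p : B → Bool) (f : A → B) xs → count p (map f xs) ≡ count (p ∘ f) xs
  count-map p f []       = refl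
  count-map p f (x ∷ xs) rewrite count-∷ p (f x) (map f xs) | count-∷ (p ∘ f) x xs | count-map p f xs = refl

  count-cong : ∀ {A : Set} {p q : A → Bool} → (∀ x → p x ≡ q x) → ∀ xs → count p xs ≡ count q xs
  count-cong p≗q []       = refl
  count-cong {p = p} {q} p≗q (x ∷ xs) rewrite count-∷ p x xs | count-∷ q x xs | p≗q x = cong (_ +_) (count-cong p≗q xs)

  count-tabulate : ∀ {A : Set} n (f : Fin n → A) (p : A → Bool) (g : ℕ → Bool) → (∀ i → p (f i) ≡ g (toℕ i)) →
                   count p (List.tabulate f) ≡ ∑ n (𝟙 ∘ g)
  count-tabulate zero    f p g eq = refl
  count-tabulate (suc n) f p g eq =
    trans (count-∷ p (f Fin.zero) (List.tabulate (f ∘ Fin.suc)))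
          (cong₂ _+_ (cong 𝟙 (eq Fin.zero)) (count-tabulate n (f ∘ Fin.suc) p (g ∘ suc) (eq ∘ Fin.suc)))

  count-cartesianProduct : ∀ {A B : Set} n (f : Fin n → A) (ys : List B) (p : A × B → Bool) (G : ℕ → ℕ) →
                           (∀ i → count (λ y → p (f i , y)) ys ≡ G (toℕ i)) →
                           count p (cartesianProduct (List.tabulate f) ys) ≡ ∑ n G
  count-cartesianProduct zero    f ys p G eq = refl
  count-cartesianProduct (suc n) f ys p G eq =
    trans (count-++ p (map (f Fin.zero ,_) ys) (cartesianProduct (List.tabulate (f ∘ Fin.suc)) ys))
          (cong₂ _+_ (trans (count-map p (f Fin.zero ,_) ys) (eq Fin.zero))
                     (count-cartesianProduct n (f ∘ Fin.suc) ys p (G ∘ suc) (eq ∘ Fin.suc)))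

  count-involution : ∀ {A : Set} (xs : List A) → Unique xs → (∀ x → x ∈ xs) → (f : A → A) → (∀ x → f (f x) ≡ x) →
                     (p q : A → Bool) → (∀ x → p x ≡ q (f x)) → count p xs ≡ count q xs
  count-involution xs unique complete f f∘f p q p≡q∘f = begin
    count p xs            ≡⟨ count-cong p≡q∘f xs ⟩
    count (q ∘ f) xs      ≡⟨ count-map q f xs ⟨
    count q (map f xs)    ≡⟨ ↭-length (filter-↭ (T? ∘ q) map-f-xs↭xs) ⟩
    count q xs            ∎
    where
    open ≡-Reasoning
    f-injective : ∀ {x y} → f x ≡ f y → x ≡ y
    f-injective {x} {y} fx≡fy = trans (sym (f∘f x)) (trans (cong f fx≡fy) (f∘f y))
    map-f-xs↭xs : map f xs ↭ xs
    map-f-xs↭xs = ∼bag⇒↭ (unique∧set⇒bag (map⁺ f-injective unique) unique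
      λ {x} → mk⇔ (λ _ → complete x) (λ _ → subst (_∈ map f xs) (f∘f x) (∈-map⁺ f (complete (f x)))))

  private
    allVecs≡cartesianProductWith : ∀ m k → allVecs m (suc k) ≡ cartesianProductWith _∷_ (allFin m) (allVecs m k)
    allVecs≡cartesianProductWith m k = go (allFin m)
      where
      go : ∀ xs → concatMap (λ x → map (x ∷_) (allVecs m k)) xs ≡ cartesianProductWith _∷_ xs (allVecs m k)
      go []       = refl
      go (x ∷ xs) = cong (map (x ∷_) (allVecs m k) ++_) (go xs)

  allVecs-unique : ∀ m k → Unique (allVecs m k)
  allVecs-unique m zero    = All.[] AllPairs.∷ AllPairs.[]
  allVecs-unique m (suc k) rewrite allVecs≡cartesianProductWith m k =
    cartesianProductWith⁺ _∷_ ∷-injective (allFin⁺ m) (allVecs-unique m k)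

  allVecs-complete : ∀ m k (v : Vec (Fin m) k) → v ∈ allVecs m k
  allVecs-complete m zero    []      = here refl
  allVecs-complete m (suc k) (x ∷ v) rewrite allVecs≡cartesianProductWith m k =
    ∈-cartesianProductWith⁺ _∷_ (∈-allFin x) (allVecs-complete m k v)

  -- The partner map of a vector as a function on ℕ; the value 0 outside [0, m) is never used.

  partnerℕ : ∀ {m} → Vec (Fin m) m → ℕ → ℕ
  partnerℕ {m} v y with y <? m
  ... | yes y<m = toℕ (lookup v (fromℕ< y<m))
  ... | no _    = 0

  partnerℕ-toℕ : ∀ {m} (v : Vec (Fin m) m) i → partnerℕ v (toℕ i) ≡ partner v i
  partnerℕ-toℕ {m} v i with toℕ i <? m
  ... | yes i<m = cong (toℕ ∘ lookup v) (fromℕ<-toℕ i i<m)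
  ... | no i≮m  = ⊥-elim (i≮m (toℕ<n i))

  crossings-crossingNumber : ∀ {m} (v : Vec (Fin m) m) → crossings v ≡ crossingNumber m (partnerℕ v)
  crossings-crossingNumber {m} v =
    count-cartesianProduct m (λ i → i) (allFin m) _ _ λ i →
      count-tabulate m (λ j → j) _ (crosses (partnerℕ v) (toℕ i)) λ j → read i j
    where
    read : ∀ i j → crossesAt v i j ≡ crosses (partnerℕ v) (toℕ i) (toℕ j)
    read i j rewrite partnerℕ-toℕ v i | partnerℕ-toℕ v j = refl

  partnerℕ-< : ∀ {m} (v : Vec (Fin m) m) {y} → y < m → partnerℕ v y < m
  partnerℕ-< {m} v {y} y<m with y <? m
  ... | yes _  = toℕ<n _
  ... | no y≮m = ⊥-elim (y≮m y<m)

  ∀Fin⇒∀< : ∀ {m} {Q : ℕ → Set} → (∀ (i : Fin m) → Q (toℕ i)) → ∀ {y} → y < m → Q y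
  ∀Fin⇒∀< {Q = Q} h y<m = subst Q (toℕ-fromℕ< y<m) (h (fromℕ< y<m))

  module _ {m} (v : Vec (Fin m) m) where

    private
      matchingAt : Fin m → Bool
      matchingAt i = not (toℕ (lookup v i) ≡ᵇ toℕ i) ∧ (toℕ (lookup v (lookup v i)) ≡ᵇ toℕ i)

      partnerℕ-twice : ∀ i → partnerℕ v (partnerℕ v (toℕ i)) ≡ toℕ (lookup v (lookup v i))
      partnerℕ-twice i = trans (cong (partnerℕ v) (partnerℕ-toℕ v i)) (partnerℕ-toℕ v (lookup v i))

    isMatching⇒IsMatching : T (isMatching v) → IsMatching m (partnerℕ v)
    isMatching⇒IsMatching t = record
      { partner-<          = partnerℕ-< v
      ; partner-≢          = ∀Fin⇒∀< {Q = λ y → partnerℕ v y ≢ y} λ i eq →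
          ≢-at i (trans (sym (partnerℕ-toℕ v i)) eq)
      ; partner-involutive = ∀Fin⇒∀< {Q = λ y → partnerℕ v (partnerℕ v y) ≡ y} λ i →
          trans (partnerℕ-twice i) (≡ᵇ⇒≡ _ _ (proj₂ (at i)))
      }
      where
      at : ∀ i → T (not (toℕ (lookup v i) ≡ᵇ toℕ i)) × T (toℕ (lookup v (lookup v i)) ≡ᵇ toℕ i)
      at i = Equivalence.to T-∧ (all-allFin⁻ matchingAt t i)
      ≢-at : ∀ i → toℕ (lookup v i) ≢ toℕ i
      ≢-at i eq with toℕ (lookup v i) ≡ᵇ toℕ i | ≡⇒≡ᵇ _ _ eq | proj₁ (at i)
      ... | true | _ | ()

    IsMatching⇒isMatching : IsMatching m (partnerℕ v) → T (isMatching v)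
    IsMatching⇒isMatching M = all-allFin⁺ matchingAt λ i → Equivalence.from T-∧ (≢ᵇ i , ≡ᵇ i)
      where
      ≢ᵇ : ∀ i → T (not (toℕ (lookup v i) ≡ᵇ toℕ i))
      ≢ᵇ i with toℕ (lookup v i) ≡ᵇ toℕ i in eq
      ... | false = _
      ... | true  = partner-≢ M (toℕ<n i) (trans (partnerℕ-toℕ v i) (≡ᵇ⇒≡ _ _ (subst T (sym eq) _)))
      ≡ᵇ : ∀ i → T (toℕ (lookup v (lookup v i)) ≡ᵇ toℕ i)
      ≡ᵇ i = ≡⇒≡ᵇ _ _ (trans (sym (partnerℕ-twice i)) (partner-involutive M (toℕ<n i)))

  τFin : ∀ {m} → ℕ → Fin m → Fin m
  τFin {m} x i with τ x (toℕ i) <? m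
  ... | yes τi<m = fromℕ< τi<m
  ... | no _     = i

  toℕ-τFin : ∀ {m} x (i : Fin m) → suc x < m → toℕ (τFin x i) ≡ τ x (toℕ i)
  toℕ-τFin {m} x i 1+x<m with τ x (toℕ i) <? m
  ... | yes τi<m = toℕ-fromℕ< τi<m
  ... | no τi≮m  = ⊥-elim (τi≮m (τ-< x 1+x<m (toℕ<n i)))

  τFin-involutive : ∀ {m} x (i : Fin m) → suc x < m → τFin x (τFin x i) ≡ i
  τFin-involutive x i 1+x<m = toℕ-injective (begin
    toℕ (τFin x (τFin x i)) ≡⟨ toℕ-τFin x (τFin x i) 1+x<m ⟩
    τ x (toℕ (τFin x i))    ≡⟨ cong (τ x) (toℕ-τFin x i 1+x<m) ⟩
    τ x (τ x (toℕ i))       ≡⟨ τ-involutive x (toℕ i) ⟩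
    toℕ i                   ∎)
    where open ≡-Reasoning

  swapVertices : ∀ {m} → ℕ → Vec (Fin m) m → Vec (Fin m) m
  swapVertices x v = tabulate (τFin x ∘ lookup v ∘ τFin x)

  swapVertices-involutive : ∀ {m} x (v : Vec (Fin m) m) → suc x < m → swapVertices x (swapVertices x v) ≡ v
  swapVertices-involutive x v 1+x<m = trans (tabulate-cong at) (tabulate∘lookup v)
    where
    at : ∀ i → τFin x (lookup (swapVertices x v) (τFin x i)) ≡ lookup v i
    at i rewrite lookup∘tabulate (τFin x ∘ lookup v ∘ τFin x) (τFin x i) | τFin-involutive x i 1+x<m =
      τFin-involutive x (lookup v i) 1+x<m

  module _ {m} x (v : Vec (Fin m) m) (1+x<m : suc x < m) where

    partnerℕ-swapVertices : ∀ {y} → y < m → partnerℕ (swapVertices x v) y ≡ swapPartners x (partnerℕ v) y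
    partnerℕ-swapVertices = ∀Fin⇒∀< {Q = λ y → partnerℕ (swapVertices x v) y ≡ swapPartners x (partnerℕ v) y} λ i → begin
      partnerℕ (swapVertices x v) (toℕ i)  ≡⟨ partnerℕ-toℕ (swapVertices x v) i ⟩
      toℕ (lookup (swapVertices x v) i)    ≡⟨ cong toℕ (lookup∘tabulate (τFin x ∘ lookup v ∘ τFin x) i) ⟩
      toℕ (τFin x (lookup v (τFin x i)))   ≡⟨ toℕ-τFin x (lookup v (τFin x i)) 1+x<m ⟩
      τ x (partner v (τFin x i))           ≡⟨ cong (τ x) (partnerℕ-toℕ v (τFin x i)) ⟨
      τ x (partnerℕ v (toℕ (τFin x i)))    ≡⟨ cong (τ x ∘ partnerℕ v) (toℕ-τFin x i 1+x<m) ⟩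
      τ x (partnerℕ v (τ x (toℕ i)))       ∎
      where open ≡-Reasoning

    isMatching-swapVertices : IsMatching m (partnerℕ v) → IsMatching m (partnerℕ (swapVertices x v))
    isMatching-swapVertices M =
      isMatching-cong m (sym ∘ partnerℕ-swapVertices) (isMatching-swapPartners x m (partnerℕ v) 1+x<m M)

    crossings-swapVertices : crossings (swapVertices x v) ≡ crossingNumber m (swapPartners x (partnerℕ v))
    crossings-swapVertices = trans (crossings-crossingNumber (swapVertices x v)) (crossingNumber-cong m partnerℕ-swapVertices)

module BlockMoves where

  open import Function using (_∘_)
  open import Data.Nat
  open import Data.Nat.Properties
  open import Data.Sum using (_⊎_; inj₁; inj₂)
  open import Data.Product using (_×_; _,_; proj₁; proj₂)
  open import Data.Fin using (Fin)
  open import Data.Vec using (Vec)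
  open import Relation.Binary.PropositionalEquality
  open Crossings
  open VectorEncoding

  -- moveRight x k carries the vertex at x to x + k, moveLeft z k carries the vertex at z + k
  -- to z; the vertices passed over shift by one place.

  moveRight : ∀ {m} → ℕ → ℕ → Vec (Fin m) m → Vec (Fin m) m
  moveRight x zero    v = v
  moveRight x (suc k) v = moveRight (suc x) k (swapVertices x v)

  moveLeft : ∀ {m} → ℕ → ℕ → Vec (Fin m) m → Vec (Fin m) m
  moveLeft z zero    v = v
  moveLeft z (suc k) v = moveLeft z k (swapVertices (z + k) v)

  moveRight-suc : ∀ {m} k x (v : Vec (Fin m) m) → moveRight x (suc k) v ≡ swapVertices (x + k) (moveRight x k v)
  moveRight-suc zero    x v = cong (λ y → swapVertices y v) (sym (+-identityʳ x))
  moveRight-suc (suc k) x v =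
    trans (moveRight-suc k (suc x) (swapVertices x v)) (cong (λ y → swapVertices y (moveRight (suc x) k (swapVertices x v))) (sym (+-suc x k)))

  moveLeft∘moveRight : ∀ {m} k z (v : Vec (Fin m) m) → z + k < m → moveLeft z k (moveRight z k v) ≡ v
  moveLeft∘moveRight zero    z v _      = refl
  moveLeft∘moveRight {m} (suc k) z v z+k<m = begin
    moveLeft z k (swapVertices (z + k) (moveRight z (suc k) v))                   ≡⟨ cong (moveLeft z k ∘ swapVertices (z + k)) (moveRight-suc k z v) ⟩
    moveLeft z k (swapVertices (z + k) (swapVertices (z + k) (moveRight z k v)))  ≡⟨ cong (moveLeft z k) (swapVertices-involutive (z + k) (moveRight z k v) 1+z+k<m) ⟩
    moveLeft z k (moveRight z k v)                                                 ≡⟨ moveLeft∘moveRight k z v (<-trans (n<1+n _) 1+z+k<m) ⟩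
    v                                                                              ∎
    where
    open ≡-Reasoning
    1+z+k<m = subst (_< m) (+-suc z k) z+k<m

  moveRight∘moveLeft : ∀ {m} k z (v : Vec (Fin m) m) → z + k < m → moveRight z k (moveLeft z k v) ≡ v
  moveRight∘moveLeft zero    z v _      = refl
  moveRight∘moveLeft {m} (suc k) z v z+k<m = begin
    moveRight z (suc k) (moveLeft z k (swapVertices (z + k) v))                    ≡⟨ moveRight-suc k z (moveLeft z k (swapVertices (z + k) v)) ⟩
    swapVertices (z + k) (moveRight z k (moveLeft z k (swapVertices (z + k) v)))   ≡⟨ cong (swapVertices (z + k)) (moveRight∘moveLeft k z (swapVertices (z + k) v) (<-trans (n<1+n _) 1+z+k<m)) ⟩
    swapVertices (z + k) (swapVertices (z + k) v)                                  ≡⟨ swapVertices-involutive (z + k) v 1+z+k<m ⟩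
    v                                                                              ∎
    where
    open ≡-Reasoning
    1+z+k<m = subst (_< m) (+-suc z k) z+k<m

  module _ {m} x (v : Vec (Fin m) m) (1+x<m : suc x < m) where

    private
      P = partnerℕ v
      x<m = <-trans (n<1+n x) 1+x<m

    partnerℕ-swapVertices-fixed : ∀ {y} → y < m → y ≢ x → y ≢ suc x → P y < x →
                                  partnerℕ (swapVertices x v) y ≡ P y
    partnerℕ-swapVertices-fixed y<m y≢x y≢1+x Py<x rewrite partnerℕ-swapVertices x v 1+x<m y<m | τ-other x y≢x y≢1+x =
      τ-below x Py<x

    partnerℕ-swapVertices-right : P x ≢ x → P x ≢ suc x → partnerℕ (swapVertices x v) (suc x) ≡ P x
    partnerℕ-swapVertices-right Px≢x Px≢1+x rewrite partnerℕ-swapVertices x v 1+x<m 1+x<m | τ-right x =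
      τ-other x Px≢x Px≢1+x

    partnerℕ-swapVertices-left : P (suc x) ≢ x → P (suc x) ≢ suc x → partnerℕ (swapVertices x v) x ≡ P (suc x)
    partnerℕ-swapVertices-left P1+x≢x P1+x≢1+x rewrite partnerℕ-swapVertices x v 1+x<m x<m | τ-left x =
      τ-other x P1+x≢x P1+x≢1+x

  module _ {m} x (v : Vec (Fin m) m) (M : IsMatching m (partnerℕ v)) (1+x<m : suc x < m) where

    private
      P = partnerℕ v
      on-crossings : ∀ {c} → crossingNumber m (swapPartners x P) ≡ c → crossings (swapVertices x v) ≡ c
      on-crossings = trans (crossings-swapVertices x v 1+x<m)
      crossings-v = sym (crossings-crossingNumber v)

    crossings-swapVertices-opener-closer : suc x < P x → P (suc x) < x → crossings (swapVertices x v) + 1 ≡ crossings v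
    crossings-swapVertices-opener-closer h₁ h₂ =
      trans (cong (_+ 1) (on-crossings refl)) (trans (crossingNumber-swap-opener-closer M 1+x<m h₁ h₂) crossings-v)

    crossings-swapVertices-closer-opener : P x < x → suc x < P (suc x) → crossings (swapVertices x v) ≡ crossings v + 1
    crossings-swapVertices-closer-opener h₁ h₂ =
      on-crossings (trans (crossingNumber-swap-closer-opener M 1+x<m h₁ h₂) (cong (_+ 1) crossings-v))

    crossings-swapVertices-closers-> : P x < x → P (suc x) < x → P (suc x) < P x →
                                       crossings (swapVertices x v) ≡ crossings v + 1
    crossings-swapVertices-closers-> h₁ h₂ h₃ =
      on-crossings (trans (crossingNumber-swap-closers-> M 1+x<m h₁ h₂ h₃) (cong (_+ 1) crossings-v))

    crossings-swapVertices-closers-< : P x < x → P (suc x) < x → P x < P (suc x) →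
                                       crossings (swapVertices x v) + 1 ≡ crossings v
    crossings-swapVertices-closers-< h₁ h₂ h₃ =
      trans (cong (_+ 1) (on-crossings refl)) (trans (crossingNumber-swap-closers-< M 1+x<m h₁ h₂ h₃) crossings-v)

  moveRight-crossings : ∀ {m} k x (v : Vec (Fin m) m) {a} → IsMatching m (partnerℕ v) → x + k < m → a ≤ x →
    a ≤ partnerℕ v x → (∀ {y} → x < y → y ≤ x + k → partnerℕ v y < a) →
    (x + k < partnerℕ v x → crossings (moveRight x k v) + k ≡ crossings v) ×
    (partnerℕ v x < x → crossings (moveRight x k v) ≡ crossings v + k)
  moveRight-crossings zero    x v M _ _ _ _ = (λ _ → +-identityʳ _) , (λ _ → sym (+-identityʳ _))
  moveRight-crossings {m} (suc k) x v {a} M x+1+k<m a≤x a≤Px block = moving-opener , moving-closer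
    where
    open ≡-Reasoning
    P = partnerℕ v
    v′ = swapVertices x v
    w = moveRight (suc x) k v′
    1+x≤x+1+k : suc x ≤ x + suc k
    1+x≤x+1+k = subst (suc x ≤_) (sym (+-suc x k)) (s≤s (m≤m+n x k))
    1+x<m = ≤-<-trans 1+x≤x+1+k x+1+k<m
    x<m = <-trans (n<1+n x) 1+x<m
    P1+x<a : P (suc x) < a
    P1+x<a = block (n<1+n x) 1+x≤x+1+k
    Px≢1+x : P x ≢ suc x
    Px≢1+x Px≡1+x = <⇒≱ P1+x<a (subst (a ≤_) (trans (sym (partner-involutive M x<m)) (cong P Px≡1+x)) a≤x)
    P′1+x : partnerℕ v′ (suc x) ≡ P x
    P′1+x = partnerℕ-swapVertices-right x v 1+x<m (partner-≢ M x<m) Px≢1+x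
    block′ : ∀ {y} → suc x < y → y ≤ suc x + k → partnerℕ v′ y < a
    block′ {y} 1+x<y y≤1+x+k = subst (_< a) (sym (partnerℕ-swapVertices-fixed x v 1+x<m y<m y≢x y≢1+x (<-≤-trans Py<a a≤x))) Py<a
      where
      y≤x+1+k = subst (y ≤_) (sym (+-suc x k)) y≤1+x+k
      y<m = ≤-<-trans y≤x+1+k x+1+k<m
      y≢x = λ y≡x → <-asym 1+x<y (subst (_< suc x) (sym y≡x) (n<1+n x))
      y≢1+x = λ y≡1+x → <-irrefl (sym y≡1+x) 1+x<y
      Py<a = block (<-trans (n<1+n x) 1+x<y) y≤x+1+k
    moved = moveRight-crossings k (suc x) v′ (isMatching-swapVertices x v 1+x<m M) (subst (_< m) (+-suc x k) x+1+k<m)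
              (≤-trans a≤x (n≤1+n x)) (subst (a ≤_) (sym P′1+x) a≤Px) block′
    moving-opener : x + suc k < P x → crossings w + suc k ≡ crossings v
    moving-opener x+1+k<Px = begin
      crossings w + suc k   ≡⟨ +-suc _ k ⟩
      suc (crossings w + k) ≡⟨ cong suc (proj₁ moved (subst₂ _<_ (+-suc x k) (sym P′1+x) x+1+k<Px)) ⟩
      suc (crossings v′)    ≡⟨ +-comm 1 _ ⟩
      crossings v′ + 1      ≡⟨ crossings-swapVertices-opener-closer x v M 1+x<m (≤-<-trans 1+x≤x+1+k x+1+k<Px) (<-≤-trans P1+x<a a≤x) ⟩
      crossings v           ∎
    moving-closer : P x < x → crossings w ≡ crossings v + suc k
    moving-closer Px<x = begin
      crossings w            ≡⟨ proj₂ moved (subst (_< suc x) (sym P′1+x) (<-trans Px<x (n<1+n x))) ⟩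
      crossings v′ + k       ≡⟨ cong (_+ k) (crossings-swapVertices-closers-> x v M 1+x<m Px<x (<-≤-trans P1+x<a a≤x) (<-≤-trans P1+x<a a≤Px)) ⟩
      crossings v + 1 + k    ≡⟨ +-assoc (crossings v) 1 k ⟩
      crossings v + suc k    ∎

  moveLeft-crossings : ∀ {m} k z (v : Vec (Fin m) m) {a} → IsMatching m (partnerℕ v) → z + k < m → a ≤ z →
    a ≤ partnerℕ v (z + k) → (∀ {y} → z ≤ y → y < z + k → partnerℕ v y < a) →
    (z + k < partnerℕ v (z + k) → crossings (moveLeft z k v) ≡ crossings v + k) ×
    (partnerℕ v (z + k) < z → crossings (moveLeft z k v) + k ≡ crossings v)
  moveLeft-crossings zero    z v M _ _ _ _ = (λ _ → sym (+-identityʳ _)) , (λ _ → +-identityʳ _)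
  moveLeft-crossings {m} (suc k) z v {a} M z+1+k<m a≤z a≤Py block = moving-opener , moving-closer
    where
    open ≡-Reasoning
    P = partnerℕ v
    x = z + k
    v′ = swapVertices x v
    w = moveLeft z k v′
    y≡1+x : z + suc k ≡ suc x
    y≡1+x = +-suc z k
    1+x<m = subst (_< m) y≡1+x z+1+k<m
    x<m = <-trans (n<1+n x) 1+x<m
    a≤x = ≤-trans a≤z (m≤m+n z k)
    Px<a : P x < a
    Px<a = block (m≤m+n z k) (subst (x <_) (sym y≡1+x) (n<1+n x))
    P1+x≡Py : P (suc x) ≡ P (z + suc k)
    P1+x≡Py = cong P (sym y≡1+x)
    P1+x≢x : P (suc x) ≢ x
    P1+x≢x P1+x≡x = <⇒≱ Px<a (subst (a ≤_) (trans (sym (partner-involutive M 1+x<m)) (cong P P1+x≡x)) (≤-trans a≤x (n≤1+n x)))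
    P′x : partnerℕ v′ x ≡ P (z + suc k)
    P′x = trans (partnerℕ-swapVertices-left x v 1+x<m P1+x≢x (partner-≢ M 1+x<m)) P1+x≡Py
    block′ : ∀ {y} → z ≤ y → y < z + k → partnerℕ v′ y < a
    block′ {y} z≤y y<x = subst (_< a) (sym (partnerℕ-swapVertices-fixed x v 1+x<m y<m (<⇒≢ y<x) y≢1+x (<-≤-trans Py<a a≤x))) Py<a
      where
      y<m = <-trans y<x x<m
      y≢1+x = λ y≡1+x → <-asym y<x (subst (x <_) (sym y≡1+x) (n<1+n x))
      Py<a = block z≤y (<-trans y<x (subst (x <_) (sym y≡1+x) (n<1+n x)))
    moved = moveLeft-crossings k z v′ (isMatching-swapVertices x v 1+x<m M) x<m a≤z (subst (a ≤_) (sym P′x) a≤Py) block′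
    moving-opener : z + suc k < P (z + suc k) → crossings w ≡ crossings v + suc k
    moving-opener y<Py = begin
      crossings w          ≡⟨ proj₁ moved (subst (x <_) (sym P′x) (<-trans (subst (x <_) (sym y≡1+x) (n<1+n x)) y<Py)) ⟩
      crossings v′ + k     ≡⟨ cong (_+ k) (crossings-swapVertices-closer-opener x v M 1+x<m (<-≤-trans Px<a a≤x) (subst₂ _<_ y≡1+x (sym P1+x≡Py) y<Py)) ⟩
      crossings v + 1 + k  ≡⟨ +-assoc (crossings v) 1 k ⟩
      crossings v + suc k  ∎
    moving-closer : P (z + suc k) < z → crossings w + suc k ≡ crossings v
    moving-closer Py<z = begin
      crossings w + suc k   ≡⟨ +-suc _ k ⟩
      suc (crossings w + k) ≡⟨ cong suc (proj₂ moved (subst (_< z) (sym P′x) Py<z)) ⟩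
      suc (crossings v′)    ≡⟨ +-comm 1 _ ⟩
      crossings v′ + 1      ≡⟨ crossings-swapVertices-closers-< x v M 1+x<m (<-≤-trans Px<a a≤x)
                                 (subst (_< x) (sym P1+x≡Py) (<-≤-trans Py<z (m≤m+n z k)))
                                 (<-≤-trans Px<a (subst (a ≤_) (sym P1+x≡Py) a≤Py)) ⟩
      crossings v           ∎

  -- Six vertices, read as the three edges {p₁, p₂}, {p₃, p₄}, {p₅, p₆}.

  record Six : Set where
    constructor six
    field p₁ p₂ p₃ p₄ p₅ p₆ : ℕ

  open Six public

  All₆ : (ℕ → Set) → Six → Set
  All₆ Q (six u₁ u₂ u₃ u₄ u₅ u₆) = Q u₁ × Q u₂ × Q u₃ × Q u₄ × Q u₅ × Q u₆

  Pointwise₆ : (ℕ → ℕ → Set) → Six → Six → Set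
  Pointwise₆ R (six u₁ u₂ u₃ u₄ u₅ u₆) (six w₁ w₂ w₃ w₄ w₅ w₆) =
    R u₁ w₁ × R u₂ w₂ × R u₃ w₃ × R u₄ w₄ × R u₅ w₅ × R u₆ w₆

  map₆ : (ℕ → ℕ) → Six → Six
  map₆ f (six u₁ u₂ u₃ u₄ u₅ u₆) = six (f u₁) (f u₂) (f u₃) (f u₄) (f u₅) (f u₆)

  all₆-map : ∀ {Q Q′ : ℕ → Set} {s} → (∀ {u} → Q u → Q′ u) → All₆ Q s → All₆ Q′ s
  all₆-map {s = six _ _ _ _ _ _} f (q₁ , q₂ , q₃ , q₄ , q₅ , q₆) = f q₁ , f q₂ , f q₃ , f q₄ , f q₅ , f q₆

  pointwise₆⇒all₆ : ∀ {R : ℕ → ℕ → Set} {Q : ℕ → Set} {s t} → (∀ {u u′} → R u u′ → Q u) → Pointwise₆ R s t → All₆ Q s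
  pointwise₆⇒all₆ {s = six _ _ _ _ _ _} {six _ _ _ _ _ _} f (r₁ , r₂ , r₃ , r₄ , r₅ , r₆) =
    f r₁ , f r₂ , f r₃ , f r₄ , f r₅ , f r₆

  pointwise₆-map : ∀ {R R′ : ℕ → ℕ → Set} {s t} (f : ℕ → ℕ) → (∀ {u u′} → R u u′ → R′ (f u) u′) →
                   Pointwise₆ R s t → Pointwise₆ R′ (map₆ f s) t
  pointwise₆-map {s = six _ _ _ _ _ _} {six _ _ _ _ _ _} f g (r₁ , r₂ , r₃ , r₄ , r₅ , r₆) =
    g r₁ , g r₂ , g r₃ , g r₄ , g r₅ , g r₆

  pointwise₆-≡ : ∀ {R : ℕ → ℕ → Set} {s t} → (∀ {u u′} → R u u′ → u ≡ u′) → Pointwise₆ R s t → s ≡ t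
  pointwise₆-≡ {s = six _ _ _ _ _ _} {six _ _ _ _ _ _} f (r₁ , r₂ , r₃ , r₄ , r₅ , r₆)
    with refl ← f r₁ | refl ← f r₂ | refl ← f r₃ | refl ← f r₄ | refl ← f r₅ | refl ← f r₆ = refl

  record ThreeEdgesFrom {m} (v : Vec (Fin m) m) (a : ℕ) (s : Six) : Set where
    field
      matching      : IsMatching m (partnerℕ v)
      edge₁         : partnerℕ v (p₁ s) ≡ p₂ s
      edge₂         : partnerℕ v (p₃ s) ≡ p₄ s
      edge₃         : partnerℕ v (p₅ s) ≡ p₆ s
      lower         : All₆ (a ≤_) s
      upper         : All₆ (_< m) s
      closesEarlier : ∀ {y} → a ≤ y → y < m → All₆ (y ≢_) s → partnerℕ v y < a

  open ThreeEdgesFrom public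

  module _ {m} {v : Vec (Fin m) m} {a s} (E : ThreeEdgesFrom v a s) where

    edge₁⁻¹ : partnerℕ v (p₂ s) ≡ p₁ s
    edge₁⁻¹ = trans (cong (partnerℕ v) (sym (edge₁ E))) (partner-involutive (matching E) (proj₁ (upper E)))

    edge₂⁻¹ : partnerℕ v (p₄ s) ≡ p₃ s
    edge₂⁻¹ = trans (cong (partnerℕ v) (sym (edge₂ E))) (partner-involutive (matching E) (proj₁ (proj₂ (proj₂ (upper E)))))

    edge₃⁻¹ : partnerℕ v (p₆ s) ≡ p₅ s
    edge₃⁻¹ = trans (cong (partnerℕ v) (sym (edge₃ E))) (partner-involutive (matching E) (proj₁ (proj₂ (proj₂ (proj₂ (proj₂ (upper E)))))))

    closesEarlier-outside : ∀ {lo hi y} → a ≤ lo → All₆ (λ u → u < lo ⊎ hi ≤ u) s → lo ≤ y → y < hi → y < m →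
                            partnerℕ v y < a
    closesEarlier-outside {lo} {hi} {y} a≤lo outside lo≤y y<hi y<m =
      closesEarlier E (≤-trans a≤lo lo≤y) y<m (all₆-map {Q = λ u → u < lo ⊎ hi ≤ u} {y ≢_} {s} y≢ outside)
      where
      y≢ : ∀ {u} → u < lo ⊎ hi ≤ u → y ≢ u
      y≢ (inj₁ u<lo) refl = <⇒≱ u<lo lo≤y
      y≢ (inj₂ hi≤u) refl = <⇒≱ y<hi hi≤u

  threeEdgesFrom-≡ : ∀ {m} {v : Vec (Fin m) m} {a s t} {R : ℕ → ℕ → Set} → (∀ {u u′} → R u u′ → u ≡ u′) →
                     Pointwise₆ R s t → ThreeEdgesFrom v a s → ThreeEdgesFrom v a t
  threeEdgesFrom-≡ {v = v} {a} f r = subst (ThreeEdgesFrom v a) (pointwise₆-≡ f r)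

  threeEdgesFrom-swapVertices : ∀ {m} {v : Vec (Fin m) m} {a s} x → a ≤ x → suc x < m →
                                ThreeEdgesFrom v a s → ThreeEdgesFrom (swapVertices x v) a (map₆ (τ x) s)
  threeEdgesFrom-swapVertices {m} {v} {a} {s} x a≤x 1+x<m E = record
    { matching      = isMatching-swapVertices x v 1+x<m (matching E)
    ; edge₁         = edge (proj₁ (upper E)) (edge₁ E)
    ; edge₂         = edge (proj₁ (proj₂ (proj₂ (upper E)))) (edge₂ E)
    ; edge₃         = edge (proj₁ (proj₂ (proj₂ (proj₂ (proj₂ (upper E)))))) (edge₃ E)
    ; lower         = all₆-map {Q = a ≤_} {λ u → a ≤ τ x u} {s} (≤-τ x a≤x) (lower E)
    ; upper         = all₆-map {Q = _< m} {λ u → τ x u < m} {s} (τ-< x 1+x<m) (upper E)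
    ; closesEarlier = others
    }
    where
    edge : ∀ {u w} → u < m → partnerℕ v u ≡ w → partnerℕ (swapVertices x v) (τ x u) ≡ τ x w
    edge {u} u<m refl rewrite partnerℕ-swapVertices x v 1+x<m (τ-< x 1+x<m u<m) | τ-involutive x u = refl
    others : ∀ {y} → a ≤ y → y < m → All₆ (y ≢_) (map₆ (τ x) s) → partnerℕ (swapVertices x v) y < a
    others {y} a≤y y<m y∉ rewrite partnerℕ-swapVertices x v 1+x<m y<m = subst (_< a) (sym (τ-below x (<-≤-trans earlier a≤x))) earlier
      where
      τy≢ : ∀ {u} → y ≢ τ x u → τ x y ≢ u
      τy≢ {u} y≢τu τy≡u = y≢τu (trans (sym (τ-involutive x y)) (cong (τ x) τy≡u))
      earlier = closesEarlier E (≤-τ x a≤x a≤y) (τ-< x 1+x<m y<m) (all₆-map {Q = λ u → y ≢ τ x u} {s = s} τy≢ y∉)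

  MovesRight : ℕ → ℕ → ℕ → ℕ → Set
  MovesRight x k u u′ = (u ≡ x × u′ ≡ x + k) ⊎ ((u < x ⊎ x + k < u) × u′ ≡ u)

  MovesLeft : ℕ → ℕ → ℕ → ℕ → Set
  MovesLeft z k u u′ = (u ≡ z + k × u′ ≡ z) ⊎ ((u < z ⊎ z + k < u) × u′ ≡ u)

  threeEdgesFrom-moveRight : ∀ {m} k x {v : Vec (Fin m) m} {a s t} → a ≤ x → x + k < m →
                             Pointwise₆ (MovesRight x k) s t → ThreeEdgesFrom v a s → ThreeEdgesFrom (moveRight x k v) a t
  threeEdgesFrom-moveRight zero x a≤x _ = threeEdgesFrom-≡ fixed
    where
    fixed : ∀ {u u′} → MovesRight x 0 u u′ → u ≡ u′
    fixed (inj₁ (u≡x , u′≡x+0)) = trans u≡x (trans (sym (+-identityʳ x)) (sym u′≡x+0))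
    fixed (inj₂ (_ , u′≡u))     = sym u′≡u
  threeEdgesFrom-moveRight {m} (suc k) x {v} {a} {s} {t} a≤x x+1+k<m moves E =
    threeEdgesFrom-moveRight k (suc x) (≤-trans a≤x (n≤1+n x)) (subst (_< m) (+-suc x k) x+1+k<m)
      (pointwise₆-map {R = MovesRight x (suc k)} {MovesRight (suc x) k} {s} {t} (τ x) step moves)
      (threeEdgesFrom-swapVertices x a≤x (≤-<-trans 1+x≤x+1+k x+1+k<m) E)
    where
    1+x≤x+1+k : suc x ≤ x + suc k
    1+x≤x+1+k = subst (suc x ≤_) (sym (+-suc x k)) (s≤s (m≤m+n x k))
    step : ∀ {u u′} → MovesRight x (suc k) u u′ → MovesRight (suc x) k (τ x u) u′
    step (inj₁ (refl , u′≡)) = inj₁ (τ-left x , trans u′≡ (+-suc x k))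
    step {u} (inj₂ (inj₁ u<x , refl)) = inj₂ (inj₁ (subst (_< suc x) (sym (τ-below x u<x)) (<-trans u<x (n<1+n x))) , sym (τ-below x u<x))
    step {u} (inj₂ (inj₂ x+1+k<u , refl)) =
      inj₂ (inj₂ (subst₂ _<_ (+-suc x k) (sym (τ-above x 1+x<u)) x+1+k<u) , sym (τ-above x 1+x<u))
      where 1+x<u = ≤-<-trans 1+x≤x+1+k x+1+k<u

  threeEdgesFrom-moveLeft : ∀ {m} k z {v : Vec (Fin m) m} {a s t} → a ≤ z → z + k < m →
                            Pointwise₆ (MovesLeft z k) s t → ThreeEdgesFrom v a s → ThreeEdgesFrom (moveLeft z k v) a t
  threeEdgesFrom-moveLeft zero z a≤z _ = threeEdgesFrom-≡ fixed
    where
    fixed : ∀ {u u′} → MovesLeft z 0 u u′ → u ≡ u′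
    fixed (inj₁ (u≡z+0 , u′≡z)) = trans u≡z+0 (trans (+-identityʳ z) (sym u′≡z))
    fixed (inj₂ (_ , u′≡u))     = sym u′≡u
  threeEdgesFrom-moveLeft {m} (suc k) z {v} {a} {s} {t} a≤z z+1+k<m moves E =
    threeEdgesFrom-moveLeft k z a≤z (<-trans (n<1+n x) 1+x<m)
      (pointwise₆-map {R = MovesLeft z (suc k)} {MovesLeft z k} {s} {t} (τ x) step moves)
      (threeEdgesFrom-swapVertices x (≤-trans a≤z (m≤m+n z k)) 1+x<m E)
    where
    x = z + k
    y≡1+x : z + suc k ≡ suc x
    y≡1+x = +-suc z k
    1+x<m = subst (_< m) y≡1+x z+1+k<m
    step : ∀ {u u′} → MovesLeft z (suc k) u u′ → MovesLeft z k (τ x u) u′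
    step (inj₁ (refl , u′≡z)) = inj₁ (trans (cong (τ x) y≡1+x) (τ-right x) , u′≡z)
    step {u} (inj₂ (inj₁ u<z , refl)) = inj₂ (inj₁ (subst (_< z) (sym (τ-below x u<x)) u<z) , sym (τ-below x u<x))
      where u<x = <-≤-trans u<z (m≤m+n z k)
    step {u} (inj₂ (inj₂ y<u , refl)) = inj₂ (inj₂ (subst (x <_) (sym (τ-above x 1+x<u)) (<-trans (n<1+n x) 1+x<u)) , sym (τ-above x 1+x<u))
      where 1+x<u = subst (_< u) y≡1+x y<u

  module _ {m} {v : Vec (Fin m) m} {a : ℕ} {s t : Six} (E : ThreeEdgesFrom v a s) where

    crossings-moveRight : ∀ k x → Pointwise₆ (MovesRight x k) s t → a ≤ x → x + k < m → a ≤ partnerℕ v x →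
      (x + k < partnerℕ v x → crossings (moveRight x k v) + k ≡ crossings v) ×
      (partnerℕ v x < x → crossings (moveRight x k v) ≡ crossings v + k)
    crossings-moveRight k x moves a≤x x+k<m a≤Px = moveRight-crossings k x v (matching E) x+k<m a≤x a≤Px block
      where
      outside : ∀ {u u′} → MovesRight x k u u′ → u < suc x ⊎ suc (x + k) ≤ u
      outside (inj₁ (refl , _))          = inj₁ (n<1+n x)
      outside (inj₂ (inj₁ u<x , _))      = inj₁ (<-trans u<x (n<1+n x))
      outside (inj₂ (inj₂ x+k<u , _))    = inj₂ x+k<u
      block : ∀ {y} → x < y → y ≤ x + k → partnerℕ v y < a
      block x<y y≤x+k = closesEarlier-outside E (≤-trans a≤x (n≤1+n x))
        (pointwise₆⇒all₆ {R = MovesRight x k} {s = s} {t} outside moves) x<y (s≤s y≤x+k) (≤-<-trans y≤x+k x+k<m)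

    crossings-moveLeft : ∀ k z → Pointwise₆ (MovesLeft z k) s t → a ≤ z → z + k < m → a ≤ partnerℕ v (z + k) →
      (z + k < partnerℕ v (z + k) → crossings (moveLeft z k v) ≡ crossings v + k) ×
      (partnerℕ v (z + k) < z → crossings (moveLeft z k v) + k ≡ crossings v)
    crossings-moveLeft k z moves a≤z z+k<m a≤Py = moveLeft-crossings k z v (matching E) z+k<m a≤z a≤Py block
      where
      outside : ∀ {u u′} → MovesLeft z k u u′ → u < z ⊎ z + k ≤ u
      outside (inj₁ (refl , _))          = inj₂ ≤-refl
      outside (inj₂ (inj₁ u<z , _))      = inj₁ u<z
      outside (inj₂ (inj₂ z+k<u , _))    = inj₂ (<⇒≤ z+k<u)
      block : ∀ {y} → z ≤ y → y < z + k → partnerℕ v y < a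
      block z≤y y<z+k = closesEarlier-outside E a≤z
        (pointwise₆⇒all₆ {R = MovesLeft z k} {s = s} {t} outside moves) z≤y y<z+k (<-trans y<z+k z+k<m)

  right-below : ∀ {x k u} → u < x → MovesRight x k u u
  right-below u<x = inj₂ (inj₁ u<x , refl)

  right-above : ∀ {x k u} → x + k < u → MovesRight x k u u
  right-above x+k<u = inj₂ (inj₂ x+k<u , refl)

  right-moved : ∀ {x k} → MovesRight x k x (x + k)
  right-moved = inj₁ (refl , refl)

  left-below : ∀ {z k u} → u < z → MovesLeft z k u u
  left-below u<z = inj₂ (inj₁ u<z , refl)

  left-above : ∀ {z k u} → z + k < u → MovesLeft z k u u
  left-above z+k<u = inj₂ (inj₂ z+k<u , refl)

  left-moved : ∀ {z k} → MovesLeft z k (z + k) z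
  left-moved = inj₁ (refl , refl)

module Exchange where

  open import Function using (_∘_)
  open import Data.Nat
  open import Data.Nat.Properties
  open import Data.Nat.Tactic.RingSolver using (solve-∀)
  open import Data.Product using (_,_; proj₁; proj₂)
  open import Data.Fin using (Fin)
  open import Data.Vec using (Vec)
  open import Relation.Binary.PropositionalEquality
  open Crossings
  open VectorEncoding
  open BlockMoves

  -- Positions are named after shape M; in shape N the last three edges are {a, a″}, {a′, e}
  -- and {b′, c′}.

  record Gaps : Set where
    constructor gaps
    field n₁ n₂ n₃ n₄ n₅ : ℕ

  module Shapes (a : ℕ) (g : Gaps) where

    open Gaps g

    a′ b c d b′ c′ a″ e : ℕ
    a′ = suc (a + n₁)
    b  = suc a′ + n₂
    c  = suc (b + n₃)
    d  = c + n₄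
    b′ = suc d
    c′ = suc (b′ + n₅)
    a″ = suc a′ + n₄
    e  = suc a′ + suc (n₃ + n₄)

    e+n₂≡d : e + n₂ ≡ d
    e+n₂≡d = shift a′ n₂ n₃ n₄
      where
      shift : ∀ a′ n₂ n₃ n₄ → suc a′ + suc (n₃ + n₄) + n₂ ≡ suc (suc a′ + n₂ + n₃) + n₄
      shift = solve-∀

    e≡1+a″+n₃ : e ≡ suc a″ + n₃
    e≡1+a″+n₃ = shift a′ n₃ n₄
      where
      shift : ∀ a′ n₃ n₄ → suc a′ + suc (n₃ + n₄) ≡ suc (suc a′ + n₄) + n₃
      shift = solve-∀

    shapeM shapeN : Six
    shapeM = six a a′ b b′ c c′
    shapeN = six a a″ a′ e b′ c′

    a<a′ : a < a′
    a<a′ = s≤s (m≤m+n a n₁)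
    a′<1+a′ = n<1+n a′
    1+a′≤b : suc a′ ≤ b
    1+a′≤b = m≤m+n (suc a′) n₂
    b<c : b < c
    b<c = s≤s (m≤m+n b n₃)
    c≤d : c ≤ d
    c≤d = m≤m+n c n₄
    d<b′ = n<1+n d
    b′<c′ : b′ < c′
    b′<c′ = s≤s (m≤m+n b′ n₅)
    a″<e : a″ < e
    a″<e = +-monoʳ-< (suc a′) (s≤s (m≤n+m n₄ n₃))
    e≤d : e ≤ d
    e≤d = subst (e ≤_) e+n₂≡d (m≤m+n e n₂)

    a<1+a′ = <-trans a<a′ a′<1+a′
    a′<b = <-≤-trans a′<1+a′ 1+a′≤b
    a<b = <-trans a<a′ a′<b
    b<d = <-≤-trans b<c c≤d
    1+a′<c = ≤-<-trans 1+a′≤b b<c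
    a′<c = <-trans a′<1+a′ 1+a′<c
    a<c = <-trans a<a′ a′<c
    a′<d = <-≤-trans a′<c c≤d
    a<d = <-trans a<a′ a′<d
    1+a′<d = <-≤-trans 1+a′<c c≤d
    d<c′ = <-trans d<b′ b′<c′
    b<b′ = <-trans b<d d<b′
    b<c′ = <-trans b<b′ b′<c′
    a″<d : a″ < d
    a″<d = +-monoˡ-< n₄ 1+a′<c
    a″<b′ = <-trans a″<d d<b′
    a″<c′ = <-trans a″<b′ b′<c′
    e<b′ = ≤-<-trans e≤d d<b′
    e+n₂<b′ = subst (_< b′) (sym e+n₂≡d) d<b′
    e+n₂<c′ = <-trans e+n₂<b′ b′<c′
    1+a′≤a″ = m≤m+n (suc a′) n₄
    a′<a″ = <-≤-trans a′<1+a′ 1+a′≤a″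
    a′<e = <-trans a′<a″ a″<e
    a<e = <-trans a<a′ a′<e
    a<a″ = <-trans a<a′ a′<a″
    a′<b′ = <-trans a′<e e<b′
    c<b′ = ≤-<-trans c≤d d<b′
    c<c′ = <-trans c<b′ b′<c′

    exchange unexchange : ∀ {m} → Vec (Fin m) m → Vec (Fin m) m
    exchange   = moveLeft e n₂ ∘ moveRight (suc a′) n₄ ∘ swapVertices a′ ∘ moveLeft (suc a′) n₂ ∘ swapVertices d ∘ moveRight c n₄
    unexchange = moveLeft c n₄ ∘ swapVertices d ∘ moveRight (suc a′) n₂ ∘ swapVertices a′ ∘ moveLeft (suc a′) n₄ ∘ moveRight e n₂

    module _ {m : ℕ} (c′<m : c′ < m) where

      b′<m = <-trans b′<c′ c′<m
      d<m  = <-trans d<b′ b′<m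
      b<m  = <-trans b<d d<m
      1+a′<m = ≤-<-trans 1+a′≤b b<m
      a″<m = <-trans a″<d d<m
      e+n₂<m = subst (_< m) (sym e+n₂≡d) d<m

      module _ {p : Vec (Fin m) m} (E : ThreeEdgesFrom p a shapeM) where

        private
          moves₁ : Pointwise₆ (MovesRight c n₄) shapeM (six a a′ b b′ d c′)
          moves₁ = right-below a<c , right-below a′<c , right-below b<c , right-above d<b′ , right-moved , right-above d<c′
          v₁ = moveRight c n₄ p
          E₁ : ThreeEdgesFrom v₁ a (six a a′ b b′ d c′)
          E₁ = threeEdgesFrom-moveRight n₄ c (<⇒≤ a<c) d<m moves₁ E

          v₂ = swapVertices d v₁
          E₂ : ThreeEdgesFrom v₂ a (six a a′ b d b′ c′)
          E₂ = threeEdgesFrom-≡ {R = _≡_} (λ eq → eq)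
                 (τ-below d a<d , τ-below d a′<d , τ-below d b<d , τ-right d , τ-left d , τ-above d b′<c′)
                 (threeEdgesFrom-swapVertices d (<⇒≤ a<d) b′<m E₁)

          moves₃ : Pointwise₆ (MovesLeft (suc a′) n₂) (six a a′ b d b′ c′) (six a a′ (suc a′) d b′ c′)
          moves₃ = left-below a<1+a′ , left-below a′<1+a′ , left-moved , left-above b<d , left-above b<b′ , left-above b<c′
          v₃ = moveLeft (suc a′) n₂ v₂
          E₃ : ThreeEdgesFrom v₃ a (six a a′ (suc a′) d b′ c′)
          E₃ = threeEdgesFrom-moveLeft n₂ (suc a′) (<⇒≤ a<1+a′) b<m moves₃ E₂

          v₄ = swapVertices a′ v₃
          E₄ : ThreeEdgesFrom v₄ a (six a (suc a′) a′ d b′ c′)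
          E₄ = threeEdgesFrom-≡ {R = _≡_} (λ eq → eq)
                 (τ-below a′ a<a′ , τ-left a′ , τ-right a′ , τ-above a′ 1+a′<d , τ-above a′ (<-trans 1+a′<d d<b′) ,
                  τ-above a′ (<-trans 1+a′<d d<c′))
                 (threeEdgesFrom-swapVertices a′ (<⇒≤ a<a′) 1+a′<m E₃)

          moves₅ : Pointwise₆ (MovesRight (suc a′) n₄) (six a (suc a′) a′ d b′ c′) (six a a″ a′ d b′ c′)
          moves₅ = right-below a<1+a′ , right-moved , right-below a′<1+a′ , right-above a″<d , right-above a″<b′ , right-above a″<c′
          v₅ = moveRight (suc a′) n₄ v₄
          E₅ : ThreeEdgesFrom v₅ a (six a a″ a′ (e + n₂) b′ c′)
          E₅ = threeEdgesFrom-≡ {R = _≡_} (λ eq → eq) (refl , refl , refl , sym e+n₂≡d , refl , refl)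
                 (threeEdgesFrom-moveRight n₄ (suc a′) (<⇒≤ a<1+a′) a″<m moves₅ E₄)

          moves₆ : Pointwise₆ (MovesLeft e n₂) (six a a″ a′ (e + n₂) b′ c′) shapeN
          moves₆ = left-below a<e , left-below a″<e , left-below a′<e , left-moved , left-above e+n₂<b′ , left-above e+n₂<c′

        threeEdgesFrom-exchange : ThreeEdgesFrom (exchange p) a shapeN
        threeEdgesFrom-exchange = threeEdgesFrom-moveLeft n₂ e (<⇒≤ a<e) e+n₂<m moves₆ E₅

        -- The six steps change the number of crossings by -n₄, -1, +n₂, +1, +n₄, -n₂.
        crossings-exchange : crossings (exchange p) ≡ crossings p
        crossings-exchange = balance
          (proj₁ (crossings-moveRight E n₄ c moves₁ (<⇒≤ a<c) d<m (subst (a ≤_) (sym (edge₃ E)) (<⇒≤ (<-trans a<d d<c′))))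
                   (subst (d <_) (sym (edge₃ E)) d<c′))
          (crossings-swapVertices-opener-closer d v₁ (matching E₁) b′<m
             (subst (b′ <_) (sym (edge₃ E₁)) b′<c′) (subst (_< d) (sym (edge₂⁻¹ E₁)) b<d))
          (proj₁ (crossings-moveLeft E₂ n₂ (suc a′) moves₃ (<⇒≤ a<1+a′) b<m (subst (a ≤_) (sym (edge₂ E₂)) (<⇒≤ a<d)))
                   (subst (b <_) (sym (edge₂ E₂)) b<d))
          (crossings-swapVertices-closer-opener a′ v₃ (matching E₃) 1+a′<m
             (subst (_< a′) (sym (edge₁⁻¹ E₃)) a<a′) (subst (suc a′ <_) (sym (edge₂ E₃)) 1+a′<d))
          (proj₂ (crossings-moveRight E₄ n₄ (suc a′) moves₅ (<⇒≤ a<1+a′) a″<m (subst (a ≤_) (sym (edge₁⁻¹ E₄)) ≤-refl))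
                   (subst (_< suc a′) (sym (edge₁⁻¹ E₄)) a<1+a′))
          (proj₂ (crossings-moveLeft E₅ n₂ e moves₆ (<⇒≤ a<e) e+n₂<m (subst (a ≤_) (sym (edge₂⁻¹ E₅)) (<⇒≤ a<a′)))
                   (subst (_< e) (sym (edge₂⁻¹ E₅)) a′<e))
          where
          balance : ∀ {k₀ k₁ k₂ k₃ k₄ k₅ k₆} → k₁ + n₄ ≡ k₀ → k₂ + 1 ≡ k₁ → k₃ ≡ k₂ + n₂ → k₄ ≡ k₃ + 1 →
                    k₅ ≡ k₄ + n₄ → k₆ + n₂ ≡ k₅ → k₆ ≡ k₀
          balance {k₂ = k₂} {k₆ = k₆} refl refl refl refl refl eq₆ =
            +-cancelʳ-≡ n₂ k₆ (k₂ + 1 + n₄) (trans eq₆ (reorder k₂ n₂ n₄))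
            where
            reorder : ∀ k₂ n₂ n₄ → k₂ + n₂ + 1 + n₄ ≡ k₂ + 1 + n₄ + n₂
            reorder = solve-∀

      threeEdgesFrom-unexchange : ∀ {q : Vec (Fin m) m} → ThreeEdgesFrom q a shapeN → ThreeEdgesFrom (unexchange q) a shapeM
      threeEdgesFrom-unexchange U =
        threeEdgesFrom-moveLeft n₄ c (<⇒≤ a<c) d<m
          (left-below a<c , left-below a′<c , left-below b<c , left-above d<b′ , left-moved , left-above d<c′)
          (threeEdgesFrom-≡ {R = _≡_} (λ eq → eq)
            (τ-below d a<d , τ-below d a′<d , τ-below d b<d , τ-left d , τ-right d , τ-above d b′<c′)
            (threeEdgesFrom-swapVertices d (<⇒≤ a<d) b′<m
              (threeEdgesFrom-moveRight n₂ (suc a′) (<⇒≤ a<1+a′) b<m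
                (right-below a<1+a′ , right-below a′<1+a′ , right-moved , right-above b<d , right-above b<b′ , right-above b<c′)
                (threeEdgesFrom-≡ {R = _≡_} (λ eq → eq)
                  (τ-below a′ a<a′ , τ-right a′ , τ-left a′ , τ-above a′ 1+a′<d , τ-above a′ (<-trans 1+a′<d d<b′) ,
                   τ-above a′ (<-trans 1+a′<d d<c′))
                  (threeEdgesFrom-swapVertices a′ (<⇒≤ a<a′) 1+a′<m
                    (threeEdgesFrom-moveLeft n₄ (suc a′) (<⇒≤ a<1+a′) a″<m
                      (left-below a<1+a′ , left-moved , left-below a′<1+a′ , left-above a″<d , left-above a″<b′ , left-above a″<c′)
                      (threeEdgesFrom-≡ {R = _≡_} (λ eq → eq) (refl , refl , refl , e+n₂≡d , refl , refl)
                        (threeEdgesFrom-moveRight n₂ e (<⇒≤ a<e) e+n₂<m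
                          (right-below a<e , right-below a″<e , right-below a′<e , right-moved , right-above e+n₂<b′ ,
                           right-above e+n₂<c′)
                          U))))))))

      unexchange∘exchange : ∀ (p : Vec (Fin m) m) → unexchange (exchange p) ≡ p
      unexchange∘exchange p = begin
        moveLeft c n₄ (swapVertices d (moveRight (suc a′) n₂ (swapVertices a′ (moveLeft (suc a′) n₄ (moveRight e n₂ (moveLeft e n₂ v₅))))))
          ≡⟨ cong (moveLeft c n₄ ∘ swapVertices d ∘ moveRight (suc a′) n₂ ∘ swapVertices a′ ∘ moveLeft (suc a′) n₄) (moveRight∘moveLeft n₂ e v₅ e+n₂<m) ⟩
        moveLeft c n₄ (swapVertices d (moveRight (suc a′) n₂ (swapVertices a′ (moveLeft (suc a′) n₄ (moveRight (suc a′) n₄ v₄)))))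
          ≡⟨ cong (moveLeft c n₄ ∘ swapVertices d ∘ moveRight (suc a′) n₂ ∘ swapVertices a′) (moveLeft∘moveRight n₄ (suc a′) v₄ a″<m) ⟩
        moveLeft c n₄ (swapVertices d (moveRight (suc a′) n₂ (swapVertices a′ (swapVertices a′ v₃))))
          ≡⟨ cong (moveLeft c n₄ ∘ swapVertices d ∘ moveRight (suc a′) n₂) (swapVertices-involutive a′ v₃ 1+a′<m) ⟩
        moveLeft c n₄ (swapVertices d (moveRight (suc a′) n₂ (moveLeft (suc a′) n₂ v₂)))
          ≡⟨ cong (moveLeft c n₄ ∘ swapVertices d) (moveRight∘moveLeft n₂ (suc a′) v₂ b<m) ⟩
        moveLeft c n₄ (swapVertices d (swapVertices d v₁))
          ≡⟨ cong (moveLeft c n₄) (swapVertices-involutive d v₁ b′<m) ⟩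
        moveLeft c n₄ (moveRight c n₄ p)
          ≡⟨ moveLeft∘moveRight n₄ c p d<m ⟩
        p ∎
        where
        open ≡-Reasoning
        v₁ = moveRight c n₄ p
        v₂ = swapVertices d v₁
        v₃ = moveLeft (suc a′) n₂ v₂
        v₄ = swapVertices a′ v₃
        v₅ = moveRight (suc a′) n₄ v₄

      exchange∘unexchange : ∀ (q : Vec (Fin m) m) → exchange (unexchange q) ≡ q
      exchange∘unexchange q = begin
        moveLeft e n₂ (moveRight (suc a′) n₄ (swapVertices a′ (moveLeft (suc a′) n₂ (swapVertices d (moveRight c n₄ (moveLeft c n₄ w₅))))))
          ≡⟨ cong (moveLeft e n₂ ∘ moveRight (suc a′) n₄ ∘ swapVertices a′ ∘ moveLeft (suc a′) n₂ ∘ swapVertices d) (moveRight∘moveLeft n₄ c w₅ d<m) ⟩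
        moveLeft e n₂ (moveRight (suc a′) n₄ (swapVertices a′ (moveLeft (suc a′) n₂ (swapVertices d (swapVertices d w₄)))))
          ≡⟨ cong (moveLeft e n₂ ∘ moveRight (suc a′) n₄ ∘ swapVertices a′ ∘ moveLeft (suc a′) n₂) (swapVertices-involutive d w₄ b′<m) ⟩
        moveLeft e n₂ (moveRight (suc a′) n₄ (swapVertices a′ (moveLeft (suc a′) n₂ (moveRight (suc a′) n₂ w₃))))
          ≡⟨ cong (moveLeft e n₂ ∘ moveRight (suc a′) n₄ ∘ swapVertices a′) (moveLeft∘moveRight n₂ (suc a′) w₃ b<m) ⟩
        moveLeft e n₂ (moveRight (suc a′) n₄ (swapVertices a′ (swapVertices a′ w₂)))
          ≡⟨ cong (moveLeft e n₂ ∘ moveRight (suc a′) n₄) (swapVertices-involutive a′ w₂ 1+a′<m) ⟩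
        moveLeft e n₂ (moveRight (suc a′) n₄ (moveLeft (suc a′) n₄ w₁))
          ≡⟨ cong (moveLeft e n₂) (moveRight∘moveLeft n₄ (suc a′) w₁ a″<m) ⟩
        moveLeft e n₂ (moveRight e n₂ q)
          ≡⟨ moveLeft∘moveRight n₂ e q e+n₂<m ⟩
        q ∎
        where
        open ≡-Reasoning
        w₁ = moveRight e n₂ q
        w₂ = moveLeft (suc a′) n₄ w₁
        w₃ = swapVertices a′ w₂
        w₄ = moveRight (suc a′) n₂ w₃
        w₅ = swapVertices d w₄

  gapsᴹ gapsᴺ : (ℕ → ℕ) → ℕ → ℕ → ℕ → Gaps
  gapsᴹ P a b c = gaps (P a ∸ suc a) (b ∸ suc (P a)) (c ∸ suc b) (P b ∸ suc c) (P c ∸ suc (P b))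
  gapsᴺ P a b c = gaps (b ∸ suc a) (c ∸ suc (P b)) (P b ∸ suc (P a)) (P a ∸ suc b) (P c ∸ suc c)

  private
    fill : ∀ {x y} → x < y → suc x + (y ∸ suc x) ≡ y
    fill = m+[n∸m]≡n

  shapeM-positions : ∀ (P : ℕ → ℕ) {a b c} → a < P a → P a < b → b < c → c < P b → P b < P c →
                     Pointwise₆ _≡_ (Shapes.shapeM a (gapsᴹ P a b c)) (six a (P a) b (P b) c (P c))
  shapeM-positions P {a} {b} {c} a<Pa Pa<b b<c c<Pb Pb<Pc = refl , a′≡Pa , b≡b , b′≡Pb , c≡c , c′≡Pc
    where
    a′≡Pa = fill a<Pa
    b≡b   = trans (cong (λ x → suc x + (b ∸ suc (P a))) a′≡Pa) (fill Pa<b)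
    c≡c   = trans (cong (λ x → suc (x + (c ∸ suc b))) b≡b) (fill b<c)
    b′≡Pb = trans (cong (λ x → suc (x + (P b ∸ suc c))) c≡c) (fill c<Pb)
    c′≡Pc = trans (cong (λ x → suc (x + (P c ∸ suc (P b)))) b′≡Pb) (fill Pb<Pc)

  shapeN-positions : ∀ (P : ℕ → ℕ) {a b c} → a < b → b < P a → P a < P b → P b < c → c < P c →
                     Pointwise₆ _≡_ (Shapes.shapeN a (gapsᴺ P a b c)) (six a (P a) b (P b) c (P c))
  shapeN-positions P {a} {b} {c} a<b b<Pa Pa<Pb Pb<c c<Pc = refl , a″≡Pa , a′≡b , e≡Pb , b′≡c , c′≡Pc
    where
    open Shapes a (gapsᴺ P a b c) using (a′; a″; e; d; e+n₂≡d; e≡1+a″+n₃)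
    a′≡b  = fill a<b
    a″≡Pa = trans (cong (λ x → suc x + (P a ∸ suc b)) a′≡b) (fill b<Pa)
    e≡Pb  = trans e≡1+a″+n₃ (trans (cong (λ x → suc x + (P b ∸ suc (P a))) a″≡Pa) (fill Pa<Pb))
    b′≡c  = trans (cong suc (sym e+n₂≡d)) (trans (cong (λ x → suc (x + (c ∸ suc (P b)))) e≡Pb) (fill Pb<c))
    c′≡Pc = trans (cong (λ x → suc (x + (P c ∸ suc c))) b′≡c) (fill c<Pc)

  module _ (a : ℕ) (g : Gaps) where

    open Gaps g
    open Shapes a g

    private
      1+a+n₁∸1+a : a′ ∸ suc a ≡ n₁
      1+a+n₁∸1+a = m+n∸m≡n (suc a) n₁
      d∸e≡n₂ : d ∸ e ≡ n₂
      d∸e≡n₂ = trans (cong (_∸ e) (sym e+n₂≡d)) (m+n∸m≡n e n₂)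
      e∸1+a″≡n₃ : e ∸ suc a″ ≡ n₃
      e∸1+a″≡n₃ = trans (cong (_∸ suc a″) e≡1+a″+n₃) (m+n∸m≡n (suc a″) n₃)

    gapsᴹ-readback : ∀ (R : ℕ → ℕ) → R a ≡ a′ → R b ≡ b′ → R c ≡ c′ → gapsᴹ R a b c ≡ g
    gapsᴹ-readback R Ra≡a′ Rb≡b′ Rc≡c′ rewrite Ra≡a′ | Rb≡b′ | Rc≡c′ | 1+a+n₁∸1+a
      | m+n∸m≡n (suc a′) n₂ | m+n∸m≡n b n₃ | m+n∸m≡n (suc c) n₄ | m+n∸m≡n (suc b′) n₅ = refl

    gapsᴺ-readback : ∀ (Q : ℕ → ℕ) → Q a ≡ a″ → Q a′ ≡ e → Q b′ ≡ c′ → gapsᴺ Q a a′ b′ ≡ g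
    gapsᴺ-readback Q Qa≡a″ Qa′≡e Qb′≡c′ rewrite Qa≡a″ | Qa′≡e | Qb′≡c′ | 1+a+n₁∸1+a | d∸e≡n₂ | e∸1+a″≡n₃
      | m+n∸m≡n (suc a′) n₄ | m+n∸m≡n (suc b′) n₅ = refl

module LastThree where

  open import Function using (_⇔_; mk⇔; Equivalence)
  open import Function.Construct.Composition using (_⇔-∘_)
  open import Data.Nat
  open import Data.Nat.Properties
  open import Data.Bool using (Bool; true; false; _∧_; _∨_; not; T)
  open import Data.Bool.Properties using (T-∧; T-∨)
  open import Data.Empty using (⊥-elim)
  open import Data.Sum using (_⊎_; inj₁; inj₂)
  open import Data.Product using (_×_; _,_; proj₁; proj₂)
  open import Data.Product.Function.NonDependent.Propositional using (_×-⇔_)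
  open import Data.Fin using (Fin; toℕ)
  open import Data.Fin.Properties using (toℕ<n)
  open import Data.Vec using (Vec)
  open import Data.List using (allFin)
  open import Data.Bool.ListAction using (all)
  open import Relation.Nullary using (yes; no)
  open import Relation.Binary.PropositionalEquality
  open import Relation.Binary.Definitions using (tri<; tri≈; tri>)
  open Crossings
  open VectorEncoding
  open BlockMoves

  <ᵇ⇔< : ∀ {x y x′ y′} → x ≡ x′ → y ≡ y′ → T (x <ᵇ y) ⇔ x′ < y′
  <ᵇ⇔< {x} {y} refl refl = mk⇔ (<ᵇ⇒< x y) <⇒<ᵇ

  ∧⇔× : ∀ {b₁ b₂} {A₁ A₂ : Set} → T b₁ ⇔ A₁ → T b₂ ⇔ A₂ → T (b₁ ∧ b₂) ⇔ (A₁ × A₂)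
  ∧⇔× e₁ e₂ = (e₁ ×-⇔ e₂) ⇔-∘ T-∧

  ∨-introˡ : ∀ {x} y → T x → T (x ∨ y)
  ∨-introˡ {true} _ _ = _

  ∨-introʳ : ∀ x {y} → T y → T (x ∨ y)
  ∨-introʳ true  _ = _
  ∨-introʳ false t = t

  NoOtherOpener : (ℕ → ℕ) → ℕ → ℕ → ℕ → ℕ → Set
  NoOtherOpener P m a b c = ∀ {y} → y < m → y < P y → y < a ⊎ y ≡ a ⊎ y ≡ b ⊎ y ≡ c

  LastThree : (ℕ → ℕ) → ℕ → ℕ → ℕ → ℕ → Set
  LastThree P m a b c = a < P a × b < P b × c < P c × a < b × b < c × NoOtherOpener P m a b c

  ShapeM : (ℕ → ℕ) → ℕ → ℕ → ℕ → Set
  ShapeM P a b c = P a < b × b < c × c < P b × P b < P c × a < P a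

  ShapeN : (ℕ → ℕ) → ℕ → ℕ → ℕ → Set
  ShapeN P a b c = a < b × b < P a × P a < P b × P b < c × c < P c

  module _ {m} (v : Vec (Fin m) m) (a b c : Fin m) where

    private
      P = partnerℕ v
      A = toℕ a
      B = toℕ b
      C = toℕ c
      p : ∀ i → partner v i ≡ P (toℕ i)
      p i = sym (partnerℕ-toℕ v i)

    patternM⇔ : T (patternM v a b c) ⇔ ShapeM P A B C
    patternM⇔ = ∧⇔× (<ᵇ⇔< (p a) refl) (∧⇔× (<ᵇ⇔< refl refl) (∧⇔× (<ᵇ⇔< refl (p b))
                  (∧⇔× (<ᵇ⇔< (p b) (p c)) (<ᵇ⇔< refl (p a)))))

    patternN⇔ : T (patternN v a b c) ⇔ ShapeN P A B C
    patternN⇔ = ∧⇔× (<ᵇ⇔< refl refl) (∧⇔× (<ᵇ⇔< refl (p a)) (∧⇔× (<ᵇ⇔< (p a) (p b))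
                  (∧⇔× (<ᵇ⇔< (p b) refl) (<ᵇ⇔< refl (p c)))))

    private
      opener⇔ : ∀ i → T (opener v i) ⇔ toℕ i < P (toℕ i)
      opener⇔ i = <ᵇ⇔< refl (p i)

      earlierOrListed : Fin m → Bool
      earlierOrListed i = not (opener v i) ∨ (toℕ i <ᵇ A) ∨ (toℕ i ≡ᵇ A) ∨ (toℕ i ≡ᵇ B) ∨ (toℕ i ≡ᵇ C)

      listed⁻ : ∀ {y} → T ((y <ᵇ A) ∨ (y ≡ᵇ A) ∨ (y ≡ᵇ B) ∨ (y ≡ᵇ C)) →
                y < A ⊎ y ≡ A ⊎ y ≡ B ⊎ y ≡ C
      listed⁻ {y} t with Equivalence.to T-∨ t
      ... | inj₁ y<a = inj₁ (<ᵇ⇒< y _ y<a)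
      ... | inj₂ t′ with Equivalence.to T-∨ t′
      ...   | inj₁ y≡a = inj₂ (inj₁ (≡ᵇ⇒≡ y _ y≡a))
      ...   | inj₂ t″ with Equivalence.to T-∨ t″
      ...     | inj₁ y≡b = inj₂ (inj₂ (inj₁ (≡ᵇ⇒≡ y _ y≡b)))
      ...     | inj₂ y≡c = inj₂ (inj₂ (inj₂ (≡ᵇ⇒≡ y _ y≡c)))

      listed⁺ : ∀ {y} → y < A ⊎ y ≡ A ⊎ y ≡ B ⊎ y ≡ C →
                T ((y <ᵇ A) ∨ (y ≡ᵇ A) ∨ (y ≡ᵇ B) ∨ (y ≡ᵇ C))
      listed⁺ {y} (inj₁ y<a)               = ∨-introˡ _ (<⇒<ᵇ y<a)
      listed⁺ {y} (inj₂ (inj₁ y≡a))        = ∨-introʳ (y <ᵇ A) (∨-introˡ _ (≡⇒≡ᵇ _ _ y≡a))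
      listed⁺ {y} (inj₂ (inj₂ (inj₁ y≡b))) = ∨-introʳ (y <ᵇ A) (∨-introʳ (y ≡ᵇ A) (∨-introˡ _ (≡⇒≡ᵇ _ _ y≡b)))
      listed⁺ {y} (inj₂ (inj₂ (inj₂ y≡c))) = ∨-introʳ (y <ᵇ A) (∨-introʳ (y ≡ᵇ A) (∨-introʳ (y ≡ᵇ B) (≡⇒≡ᵇ _ _ y≡c)))

      Listed : ℕ → Set
      Listed y = y < A ⊎ y ≡ A ⊎ y ≡ B ⊎ y ≡ C

      noOtherOpener⇔ : T (all earlierOrListed (allFin m)) ⇔ NoOtherOpener P m A B C
      noOtherOpener⇔ = mk⇔ to from
        where
        to : T (all earlierOrListed (allFin m)) → NoOtherOpener P m A B C
        to t = ∀Fin⇒∀< {Q = λ y → y < P y → Listed y} λ i opens →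
          listed⁻ (listedIfOpener (Equivalence.from (opener⇔ i) opens) (all-allFin⁻ earlierOrListed t i))
          where
          listedIfOpener : ∀ {o r} → T o → T (not o ∨ r) → T r
          listedIfOpener {true} _ r = r
        from : NoOtherOpener P m A B C → T (all earlierOrListed (allFin m))
        from h = all-allFin⁺ earlierOrListed at
          where
          at : ∀ i → T (earlierOrListed i)
          at i with opener v i in eq
          ... | false = _
          ... | true  = listed⁺ (h (toℕ<n i) (Equivalence.to (opener⇔ i) (subst T (sym eq) _)))

    lastThreeAt⇔ : T (lastThreeAt v a b c) ⇔ LastThree P m A B C
    lastThreeAt⇔ = ∧⇔× (opener⇔ a) (∧⇔× (opener⇔ b) (∧⇔× (opener⇔ c)
                     (∧⇔× (<ᵇ⇔< refl refl) (∧⇔× (<ᵇ⇔< refl refl) noOtherOpener⇔))))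

  module _ {P : ℕ → ℕ} {m a b c : ℕ} (L : LastThree P m a b c) where

    private
      a<b = proj₁ (proj₂ (proj₂ (proj₂ L)))
      b<c = proj₁ (proj₂ (proj₂ (proj₂ (proj₂ L))))
      others = proj₂ (proj₂ (proj₂ (proj₂ (proj₂ L))))

    opener-≤-last : ∀ {y} → y < m → y < P y → y ≤ c
    opener-≤-last y<m opens with others y<m opens
    ... | inj₁ y<a               = <⇒≤ (<-trans y<a (<-trans a<b b<c))
    ... | inj₂ (inj₁ refl)        = <⇒≤ (<-trans a<b b<c)
    ... | inj₂ (inj₂ (inj₁ refl)) = <⇒≤ b<c
    ... | inj₂ (inj₂ (inj₂ refl)) = ≤-refl

    opener-≤-middle : ∀ {y} → y < m → y < P y → y < c → y ≤ b
    opener-≤-middle y<m opens y<c with others y<m opens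
    ... | inj₁ y<a               = <⇒≤ (<-trans y<a a<b)
    ... | inj₂ (inj₁ refl)        = <⇒≤ a<b
    ... | inj₂ (inj₂ (inj₁ refl)) = ≤-refl
    ... | inj₂ (inj₂ (inj₂ refl)) = ⊥-elim (<-irrefl refl y<c)

    opener-≤-first : ∀ {y} → y < m → y < P y → y < b → y ≤ a
    opener-≤-first y<m opens y<b with others y<m opens
    ... | inj₁ y<a               = <⇒≤ y<a
    ... | inj₂ (inj₁ refl)        = ≤-refl
    ... | inj₂ (inj₂ (inj₁ refl)) = ⊥-elim (<-irrefl refl y<b)
    ... | inj₂ (inj₂ (inj₂ refl)) = ⊥-elim (<-asym y<b b<c)

  lastThree-unique : ∀ {P m a b c a′ b′ c′} → LastThree P m a b c → LastThree P m a′ b′ c′ →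
                     a < m → b < m → c < m → a′ < m → b′ < m → c′ < m → a ≡ a′ × b ≡ b′ × c ≡ c′
  lastThree-unique {a = a} {b} {c} {a′} {b′} {c′} L@(oa , ob , oc , a<b , b<c , _) L′@(oa′ , ob′ , oc′ , a′<b′ , b′<c′ , _) a<m b<m c<m a′<m b′<m c′<m =
    a≡a′ , b≡b′ , c≡c′
    where
    c≡c′ = ≤-antisym (opener-≤-last L′ c<m oc) (opener-≤-last L c′<m oc′)
    b≡b′ = ≤-antisym (opener-≤-middle L′ b<m ob (subst (b <_) c≡c′ b<c)) (opener-≤-middle L b′<m ob′ (subst (b′ <_) (sym c≡c′) b′<c′))
    a≡a′ = ≤-antisym (opener-≤-first L′ a<m oa (subst (a <_) b≡b′ a<b)) (opener-≤-first L a′<m oa′ (subst (a′ <_) (sym b≡b′) a′<b′))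

  module _ {m} (v : Vec (Fin m) m) where

    private
      P = partnerℕ v

    lastThree⇒threeEdgesFrom : ∀ {a b c} → IsMatching m P → LastThree P m a b c → a < m → b < m → c < m →
                               ThreeEdgesFrom v a (six a (P a) b (P b) c (P c))
    lastThree⇒threeEdgesFrom {a} {b} {c} M (oa , ob , oc , a<b , b<c , others) a<m b<m c<m = record
      { matching      = M
      ; edge₁         = refl
      ; edge₂         = refl
      ; edge₃         = refl
      ; lower         = ≤-refl , <⇒≤ oa , <⇒≤ a<b , <⇒≤ (<-trans a<b ob) , <⇒≤ a<c , <⇒≤ (<-trans a<c oc)
      ; upper         = a<m , partner-< M a<m , b<m , partner-< M b<m , c<m , partner-< M c<m
      ; closesEarlier = earlier
      }
      where
      a<c = <-trans a<b b<c
      earlier : ∀ {y} → a ≤ y → y < m → All₆ (y ≢_) (six a (P a) b (P b) c (P c)) → P y < a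
      earlier {y} a≤y y<m (y≢a , y≢Pa , y≢b , y≢Pb , y≢c , y≢Pc) with <-cmp y (P y)
      ... | tri< opens _ _ with others y<m opens
      ...   | inj₁ y<a               = ⊥-elim (<⇒≱ y<a a≤y)
      ...   | inj₂ (inj₁ y≡a)        = ⊥-elim (y≢a y≡a)
      ...   | inj₂ (inj₂ (inj₁ y≡b)) = ⊥-elim (y≢b y≡b)
      ...   | inj₂ (inj₂ (inj₂ y≡c)) = ⊥-elim (y≢c y≡c)
      earlier {y} _ y<m _ | tri≈ _ y≡Py _ = ⊥-elim (partner-≢ M y<m (sym y≡Py))
      earlier {y} _ y<m (_ , y≢Pa , _ , y≢Pb , _ , y≢Pc) | tri> _ _ Py<y
        with others (partner-< M y<m) (subst (P y <_) (sym (partner-involutive M y<m)) Py<y)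
      ...   | inj₁ Py<a               = Py<a
      ...   | inj₂ (inj₁ Py≡a)        = ⊥-elim (y≢Pa (trans (sym (partner-involutive M y<m)) (cong P Py≡a)))
      ...   | inj₂ (inj₂ (inj₁ Py≡b)) = ⊥-elim (y≢Pb (trans (sym (partner-involutive M y<m)) (cong P Py≡b)))
      ...   | inj₂ (inj₂ (inj₂ Py≡c)) = ⊥-elim (y≢Pc (trans (sym (partner-involutive M y<m)) (cong P Py≡c)))

    threeEdgesFrom⇒lastThree : ∀ {a w₁ u₂ w₂ u₃ w₃} → ThreeEdgesFrom v a (six a w₁ u₂ w₂ u₃ w₃) →
                               a < w₁ → u₂ < w₂ → u₃ < w₃ → a < u₂ → u₂ < u₃ → LastThree P m a u₂ u₃
    threeEdgesFrom⇒lastThree {a} {w₁} {u₂} {w₂} {u₃} {w₃} E a<w₁ u₂<w₂ u₃<w₃ a<u₂ u₂<u₃ =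
      subst (a <_) (sym (edge₁ E)) a<w₁ , subst (u₂ <_) (sym (edge₂ E)) u₂<w₂ , subst (u₃ <_) (sym (edge₃ E)) u₃<w₃ ,
      a<u₂ , u₂<u₃ , others
      where
      others : NoOtherOpener P m a u₂ u₃
      others {y} y<m opens with y <? a
      ... | yes y<a = inj₁ y<a
      ... | no y≮a with y ≟ a | y ≟ u₂ | y ≟ u₃
      ...   | yes y≡a | _       | _       = inj₂ (inj₁ y≡a)
      ...   | no _    | yes y≡u₂ | _      = inj₂ (inj₂ (inj₁ y≡u₂))
      ...   | no _    | no _    | yes y≡u₃ = inj₂ (inj₂ (inj₂ y≡u₃))
      ...   | no y≢a  | no y≢u₂ | no y≢u₃ with y ≟ w₁ | y ≟ w₂ | y ≟ w₃
      ...     | yes refl | _        | _        = ⊥-elim (<-asym (subst (_< y) (sym (edge₁⁻¹ E)) a<w₁) opens)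
      ...     | no _     | yes refl | _        = ⊥-elim (<-asym (subst (_< y) (sym (edge₂⁻¹ E)) u₂<w₂) opens)
      ...     | no _     | no _     | yes refl = ⊥-elim (<-asym (subst (_< y) (sym (edge₃⁻¹ E)) u₃<w₃) opens)
      ...     | no y≢w₁  | no y≢w₂  | no y≢w₃  =
        ⊥-elim (<-asym (<-≤-trans (closesEarlier E (≮⇒≥ y≮a) y<m (y≢a , y≢w₁ , y≢u₂ , y≢w₂ , y≢u₃ , y≢w₃)) (≮⇒≥ y≮a)) opens)

module SwapShapes where

  open import Function using (_⇔_; Equivalence)
  open import Data.Nat
  open import Data.Nat.Properties
  open import Data.Bool using (Bool; true; false; _∧_; T)
  open import Data.Bool.Properties using (T-∧; T-≡; ¬-not; ∧-zeroʳ)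
  open import Data.Empty using (⊥-elim)
  open import Data.Maybe using (Maybe; just; nothing)
  open import Data.Product using (_×_; _,_; proj₁; proj₂; ∃-syntax)
  open import Data.Fin using (Fin; toℕ; fromℕ<)
  open import Data.Fin.Properties using (toℕ<n; toℕ-fromℕ<)
  open import Data.Vec using (Vec)
  open import Data.List using (List; _∷_; allFin; findᵇ; cartesianProduct)
  open import Data.List.Relation.Unary.Any using (here; there)
  open import Data.List.Membership.Propositional using (_∈_)
  open import Data.List.Membership.Propositional.Properties using (∈-allFin; ∈-cartesianProduct⁺)
  open import Relation.Nullary using (¬_)
  open import Relation.Binary.PropositionalEquality
  open Crossings
  open VectorEncoding
  open BlockMoves
  open Exchange
  open LastThree

  module _ {A : Set} (p : A → Bool) where

    findᵇ-sound : ∀ xs {x} → findᵇ p xs ≡ just x → T (p x)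
    findᵇ-sound (y ∷ ys) found with p y in py
    ... | true  with refl ← found = subst T (sym py) _
    ... | false = findᵇ-sound ys found

    findᵇ-complete : ∀ xs → findᵇ p xs ≡ nothing → ∀ {x} → x ∈ xs → ¬ T (p x)
    findᵇ-complete (y ∷ ys) none (here refl) px with p y
    ... | false = px
    findᵇ-complete (y ∷ ys) none (there x∈ys) px with p y
    ... | false = findᵇ-complete ys none x∈ys px

    findᵇ-succeeds : ∀ xs {x} → x ∈ xs → T (p x) → ∃[ y ] findᵇ p xs ≡ just y
    findᵇ-succeeds xs x∈xs px with findᵇ p xs in found
    ... | just y  = y , refl
    ... | nothing = ⊥-elim (findᵇ-complete xs found x∈xs px)

  Triple : ℕ → Set
  Triple m = Fin m × Fin m × Fin m

  toℕ³ : ∀ {m} → Triple m → ℕ × ℕ × ℕ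
  toℕ³ (a , b , c) = toℕ a , toℕ b , toℕ c

  triples : ∀ m → List (Triple m)
  triples m = cartesianProduct (allFin m) (cartesianProduct (allFin m) (allFin m))

  ∈-triples : ∀ {m} (t : Triple m) → t ∈ triples m
  ∈-triples (a , b , c) = ∈-cartesianProduct⁺ (∈-allFin a) (∈-cartesianProduct⁺ (∈-allFin b) (∈-allFin c))

  module _ {m} (v : Vec (Fin m) m) (pat : Fin m → Fin m → Fin m → Bool) where

    formAt : Triple m → Bool
    formAt (a , b , c) = lastThreeAt v a b c ∧ pat a b c

    findForm : Maybe (Triple m)
    findForm = findᵇ formAt (triples m)

    lastThreeForm-found : ∀ {t} → findForm ≡ just t → lastThreeForm v pat ≡ true
    lastThreeForm-found {a , b , c} found = Equivalence.to T-≡ (any-allFin⁺ _ a (any-allFin⁺ _ b (any-allFin⁺ _ c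
      (findᵇ-sound formAt (triples m) found))))

    lastThreeForm-notFound : findForm ≡ nothing → lastThreeForm v pat ≡ false
    lastThreeForm-notFound none = ¬-not λ holds → absent (subst T (sym holds) _)
      where
      absent : ¬ T (lastThreeForm v pat)
      absent t with any-allFin⁻ _ t
      ... | a , ta with any-allFin⁻ _ ta
      ...   | b , tb with any-allFin⁻ _ tb
      ...     | c , tc = findᵇ-complete formAt (triples m) none (∈-triples (a , b , c)) tc

  -- Once the last three edges of v are known, so is the outcome of every pattern search.
  module Recognise {m} {v : Vec (Fin m) m} {a w₁ u₂ w₂ u₃ w₃} (E : ThreeEdgesFrom v a (six a w₁ u₂ w₂ u₃ w₃))
                   (a<w₁ : a < w₁) (u₂<w₂ : u₂ < w₂) (u₃<w₃ : u₃ < w₃) (a<u₂ : a < u₂) (u₂<u₃ : u₂ < u₃)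
                   (pat : Fin m → Fin m → Fin m → Bool) (Shape : (ℕ → ℕ) → ℕ → ℕ → ℕ → Set)
                   (pat⇔ : ∀ x y z → T (pat x y z) ⇔ Shape (partnerℕ v) (toℕ x) (toℕ y) (toℕ z)) where

    private
      P = partnerℕ v
      L = threeEdgesFrom⇒lastThree v E a<w₁ u₂<w₂ u₃<w₃ a<u₂ u₂<u₃
      a<m  = proj₁ (upper E)
      u₂<m = proj₁ (proj₂ (proj₂ (upper E)))
      u₃<m = proj₁ (proj₂ (proj₂ (proj₂ (proj₂ (upper E)))))

    positions : ∀ t → T (formAt v pat t) → toℕ³ t ≡ (a , u₂ , u₃) × Shape P a u₂ u₃
    positions (x , y , z) holds with Equivalence.to T-∧ holds
    ... | lastThree , shape
      with refl , refl , refl ← lastThree-unique (Equivalence.to (lastThreeAt⇔ v x y z) lastThree) L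
                                  (toℕ<n x) (toℕ<n y) (toℕ<n z) a<m u₂<m u₃<m
      = refl , Equivalence.to (pat⇔ x y z) shape

    findForm-absent : ¬ Shape P a u₂ u₃ → findForm v pat ≡ nothing
    findForm-absent ¬shape with findForm v pat in found
    ... | nothing = refl
    ... | just t  = ⊥-elim (¬shape (proj₂ (positions t (findᵇ-sound (formAt v pat) (triples m) found))))

    private
      t₀ : Triple m
      t₀ = fromℕ< a<m , fromℕ< u₂<m , fromℕ< u₃<m

      at₀ : ∀ (R : ℕ → ℕ → ℕ → Set) → R a u₂ u₃ → R (toℕ (fromℕ< a<m)) (toℕ (fromℕ< u₂<m)) (toℕ (fromℕ< u₃<m))
      at₀ R r rewrite toℕ-fromℕ< a<m | toℕ-fromℕ< u₂<m | toℕ-fromℕ< u₃<m = r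

      form-t₀ : Shape P a u₂ u₃ → T (formAt v pat t₀)
      form-t₀ shape = Equivalence.from T-∧ (Equivalence.from (lastThreeAt⇔ v _ _ _) (at₀ (LastThree P m) L) ,
                                            Equivalence.from (pat⇔ _ _ _) (at₀ (Shape P) shape))

    findForm-present : Shape P a u₂ u₃ → ∃[ t ] findForm v pat ≡ just t × toℕ³ t ≡ (a , u₂ , u₃)
    findForm-present shape with findᵇ-succeeds (formAt v pat) (triples m) (∈-triples t₀) (form-t₀ shape)
    ... | t , found = t , found , proj₁ (positions t (findᵇ-sound (formAt v pat) (triples m) found))

  findᴹ findᴺ : ∀ {m} → Vec (Fin m) m → Maybe (Triple m)
  findᴹ v = findForm v (patternM v)
  findᴺ v = findForm v (patternN v)

  opaque
    exchangeAt unexchangeAt : ∀ {m} → Vec (Fin m) m → ℕ × ℕ × ℕ → Vec (Fin m) m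
    exchangeAt   p (a , b , c) = Shapes.exchange a (gapsᴹ (partnerℕ p) a b c) p
    unexchangeAt q (a , b , c) = Shapes.unexchange a (gapsᴺ (partnerℕ q) a b c) q

    exchangeAt-≡ : ∀ {m} {p : Vec (Fin m) m} {a b c g} → gapsᴹ (partnerℕ p) a b c ≡ g →
                   exchangeAt p (a , b , c) ≡ Shapes.exchange a g p
    exchangeAt-≡ refl = refl

    unexchangeAt-≡ : ∀ {m} {q : Vec (Fin m) m} {a b c g} → gapsᴺ (partnerℕ q) a b c ≡ g →
                     unexchangeAt q (a , b , c) ≡ Shapes.unexchange a g q
    unexchangeAt-≡ refl = refl

  record Exchanges {m} (leave enter : Vec (Fin m) m → Maybe (Triple m)) (back : Vec (Fin m) m → ℕ × ℕ × ℕ → Vec (Fin m) m)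
                   (p q : Vec (Fin m) m) : Set where
    field
      image-isMatching : isMatching q ≡ true
      leaves           : leave q ≡ nothing
      returns          : ∃[ t ] enter q ≡ just t × back q (toℕ³ t) ≡ p

  returns-via : ∀ {m} {found : Maybe (Triple m)} {back : ℕ × ℕ × ℕ → Vec (Fin m) m} {p position} →
                (∃[ t ] found ≡ just t × toℕ³ t ≡ position) → back position ≡ p → ∃[ t ] found ≡ just t × back (toℕ³ t) ≡ p
  returns-via {back = back} {p} (t , found , at) back≡p = t , found , subst (λ u → back u ≡ p) (sym at) back≡p

  module ExchangeFound {m} (p : Vec (Fin m) m) {a b c} (p-isMatching : isMatching p ≡ true) (found : findᴹ p ≡ just (a , b , c)) where

    private
      A = toℕ a
      B = toℕ b
      C = toℕ c
      P = partnerℕ p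
      G = gapsᴹ P A B C
      module S = Shapes A G
      E₀ : ThreeEdgesFrom p A S.shapeM
      E₀ with Equivalence.to T-∧ (findᵇ-sound _ (triples m) found)
      ... | lastThree , shape with Pa<b , b<c , c<Pb , Pb<Pc , a<Pa ← Equivalence.to (patternM⇔ p a b c) shape =
        threeEdgesFrom-≡ {R = λ u u′ → u′ ≡ u} sym (shapeM-positions P a<Pa Pa<b b<c c<Pb Pb<Pc)
          (lastThree⇒threeEdgesFrom p (isMatching⇒IsMatching p (Equivalence.from T-≡ p-isMatching))
            (Equivalence.to (lastThreeAt⇔ p a b c) lastThree) (toℕ<n a) (toℕ<n b) (toℕ<n c))
      c′<m : S.c′ < m
      c′<m = proj₂ (proj₂ (proj₂ (proj₂ (proj₂ (upper E₀)))))
      q = exchangeAt p (A , B , C)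
      q≡ : q ≡ Shapes.exchange A G p
      q≡ = exchangeAt-≡ refl
      Q = partnerℕ q
      E : ThreeEdgesFrom q A S.shapeN
      E = subst (λ w → ThreeEdgesFrom w A S.shapeN) (sym q≡) (Shapes.threeEdgesFrom-exchange A G c′<m E₀)
      module Recogniseᴹ = Recognise E S.a<a″ S.a′<e S.b′<c′ S.a<a′ S.a′<b′ (patternM q) ShapeM (patternM⇔ q)
      module Recogniseᴺ = Recognise E S.a<a″ S.a′<e S.b′<c′ S.a<a′ S.a′<b′ (patternN q) ShapeN (patternN⇔ q)
      shapeN : ShapeN Q A S.a′ S.b′
      shapeN = S.a<a′ , subst (S.a′ <_) (sym (edge₁ E)) S.a′<a″ , subst₂ _<_ (sym (edge₁ E)) (sym (edge₂ E)) S.a″<e ,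
               subst (_< S.b′) (sym (edge₂ E)) S.e<b′ , subst (S.b′ <_) (sym (edge₃ E)) S.b′<c′
      ¬shapeM : ¬ ShapeM Q A S.a′ S.b′
      ¬shapeM (Qa<a′ , _) = <-asym (subst (_< S.a′) (edge₁ E) Qa<a′) S.a′<a″

    exchanges : Exchanges findᴹ findᴺ unexchangeAt p q
    exchanges = record
      { image-isMatching = Equivalence.to T-≡ (IsMatching⇒isMatching q (matching E))
      ; leaves           = Recogniseᴹ.findForm-absent ¬shapeM
      ; returns          = returns-via {back = unexchangeAt q} (Recogniseᴺ.findForm-present shapeN) returns-at-positions
      }
      where
      returns-at-positions : unexchangeAt q (A , Shapes.a′ A G , Shapes.b′ A G) ≡ p
      returns-at-positions = begin
        unexchangeAt q (A , Shapes.a′ A G , Shapes.b′ A G) ≡⟨ unexchangeAt-≡ (gapsᴺ-readback A G Q (edge₁ E) (edge₂ E) (edge₃ E)) ⟩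
        Shapes.unexchange A G q                           ≡⟨ cong (Shapes.unexchange A G) q≡ ⟩
        Shapes.unexchange A G (Shapes.exchange A G p)     ≡⟨ Shapes.unexchange∘exchange A G c′<m p ⟩
        p                                                 ∎
        where open ≡-Reasoning

    crossings-exchangeAt : crossings q ≡ crossings p
    crossings-exchangeAt = trans (cong crossings q≡) (Shapes.crossings-exchange A G c′<m E₀)

  module UnexchangeFound {m} (q : Vec (Fin m) m) {a b c} (q-isMatching : isMatching q ≡ true) (found : findᴺ q ≡ just (a , b , c)) where

    private
      A = toℕ a
      B = toℕ b
      C = toℕ c
      Q = partnerℕ q
      G = gapsᴺ Q A B C
      module S = Shapes A G
      E₀ : ThreeEdgesFrom q A S.shapeN
      E₀ with Equivalence.to T-∧ (findᵇ-sound _ (triples m) found)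
      ... | lastThree , shape with a<b , b<Qa , Qa<Qb , Qb<c , c<Qc ← Equivalence.to (patternN⇔ q a b c) shape =
        threeEdgesFrom-≡ {R = λ u u′ → u′ ≡ u} sym (shapeN-positions Q a<b b<Qa Qa<Qb Qb<c c<Qc)
          (lastThree⇒threeEdgesFrom q (isMatching⇒IsMatching q (Equivalence.from T-≡ q-isMatching))
            (Equivalence.to (lastThreeAt⇔ q a b c) lastThree) (toℕ<n a) (toℕ<n b) (toℕ<n c))
      c′<m : S.c′ < m
      c′<m = proj₂ (proj₂ (proj₂ (proj₂ (proj₂ (upper E₀)))))
      r = unexchangeAt q (A , B , C)
      r≡ : r ≡ Shapes.unexchange A G q
      r≡ = unexchangeAt-≡ refl
      R = partnerℕ r
      E : ThreeEdgesFrom r A S.shapeM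
      E = subst (λ w → ThreeEdgesFrom w A S.shapeM) (sym r≡) (Shapes.threeEdgesFrom-unexchange A G c′<m E₀)
      module Recogniseᴹ = Recognise E S.a<a′ S.b<b′ S.c<c′ S.a<b S.b<c (patternM r) ShapeM (patternM⇔ r)
      module Recogniseᴺ = Recognise E S.a<a′ S.b<b′ S.c<c′ S.a<b S.b<c (patternN r) ShapeN (patternN⇔ r)
      shapeM : ShapeM R A S.b S.c
      shapeM = subst (_< S.b) (sym (edge₁ E)) S.a′<b , S.b<c , subst (S.c <_) (sym (edge₂ E)) S.c<b′ ,
               subst₂ _<_ (sym (edge₂ E)) (sym (edge₃ E)) S.b′<c′ , subst (A <_) (sym (edge₁ E)) S.a<a′
      ¬shapeN : ¬ ShapeN R A S.b S.c
      ¬shapeN (_ , b<Ra , _) = <-asym (subst (S.b <_) (edge₁ E) b<Ra) S.a′<b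

    unexchanges : Exchanges findᴺ findᴹ exchangeAt q r
    unexchanges = record
      { image-isMatching = Equivalence.to T-≡ (IsMatching⇒isMatching r (matching E))
      ; leaves           = Recogniseᴺ.findForm-absent ¬shapeN
      ; returns          = returns-via {back = exchangeAt r} (Recogniseᴹ.findForm-present shapeM) returns-at-positions
      }
      where
      returns-at-positions : exchangeAt r (A , Shapes.b A G , Shapes.c A G) ≡ q
      returns-at-positions = begin
        exchangeAt r (A , Shapes.b A G , Shapes.c A G) ≡⟨ exchangeAt-≡ (gapsᴹ-readback A G R (edge₁ E) (edge₂ E) (edge₃ E)) ⟩
        Shapes.exchange A G r                          ≡⟨ cong (Shapes.exchange A G) r≡ ⟩
        Shapes.exchange A G (Shapes.unexchange A G q)  ≡⟨ Shapes.exchange∘unexchange A G c′<m q ⟩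
        q                                              ∎
        where open ≡-Reasoning

  switch : ∀ {m} → Vec (Fin m) m → Bool → Maybe (Triple m) → Maybe (Triple m) → Vec (Fin m) m
  switch p true  (just t) _        = exchangeAt p (toℕ³ t)
  switch p true  nothing  (just t) = unexchangeAt p (toℕ³ t)
  switch p true  nothing  nothing  = p
  switch p false _        _        = p

  swapShapes : ∀ {m} → Vec (Fin m) m → Vec (Fin m) m
  swapShapes p = switch p (isMatching p) (findᴹ p) (findᴺ p)

  swapShapes-≡ : ∀ {m} (p : Vec (Fin m) m) {b x y} → isMatching p ≡ b → findᴹ p ≡ x → findᴺ p ≡ y →
                 swapShapes p ≡ switch p b x y
  swapShapes-≡ p refl refl refl = refl

  swapShapes-after-exchange : ∀ {m} {p q : Vec (Fin m) m} → Exchanges findᴹ findᴺ unexchangeAt p q → swapShapes q ≡ p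
  swapShapes-after-exchange {q = q} X with Exchanges.returns X
  ... | t , enters , back = trans (swapShapes-≡ q (Exchanges.image-isMatching X) (Exchanges.leaves X) enters) back

  swapShapes-after-unexchange : ∀ {m} {q r : Vec (Fin m) m} → Exchanges findᴺ findᴹ exchangeAt q r → swapShapes r ≡ q
  swapShapes-after-unexchange {r = r} X with Exchanges.returns X
  ... | t , enters , back = trans (swapShapes-≡ r (Exchanges.image-isMatching X) enters refl) back

  swapShapes-involutive : ∀ {m} (p : Vec (Fin m) m) → swapShapes (swapShapes p) ≡ p
  swapShapes-involutive p = by-cases (isMatching p) refl (findᴹ p) refl (findᴺ p) refl
    where
    by-cases : ∀ b → isMatching p ≡ b → ∀ x → findᴹ p ≡ x → ∀ y → findᴺ p ≡ y → swapShapes (swapShapes p) ≡ p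
    by-cases false im x fm y fn = trans (cong swapShapes unfold) unfold
      where unfold = swapShapes-≡ p im fm fn
    by-cases true im (just t) fm y fn =
      trans (cong swapShapes (swapShapes-≡ p im fm fn)) (swapShapes-after-exchange (ExchangeFound.exchanges p im fm))
    by-cases true im nothing fm (just t) fn =
      trans (cong swapShapes (swapShapes-≡ p im fm fn)) (swapShapes-after-unexchange (UnexchangeFound.unexchanges p im fn))
    by-cases true im nothing fm nothing fn = trans (cong swapShapes unfold) unfold
      where unfold = swapShapes-≡ p im fm fn

  accepts : (∀ {m} → Vec (Fin m) m → Fin m → Fin m → Fin m → Bool) → ℕ → ∀ {m} → Vec (Fin m) m → Bool
  accepts pat k p = isMatching p ∧ (crossings p ≡ᵇ k) ∧ lastThreeForm p (pat p)

  accepts-≡ : ∀ (pat : ∀ {m} → Vec (Fin m) m → Fin m → Fin m → Fin m → Bool) k {m} (p : Vec (Fin m) m) {b c f} →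
              isMatching p ≡ b → crossings p ≡ c → lastThreeForm p (pat p) ≡ f → accepts pat k p ≡ (b ∧ (c ≡ᵇ k) ∧ f)
  accepts-≡ _ _ _ refl refl refl = refl

  accepts-swapShapes : ∀ k {m} (p : Vec (Fin m) m) → accepts patternM k p ≡ accepts patternN k (swapShapes p)
  accepts-swapShapes k p = by-cases (isMatching p) refl (findᴹ p) refl (findᴺ p) refl
    where
    by-cases : ∀ b → isMatching p ≡ b → ∀ x → findᴹ p ≡ x → ∀ y → findᴺ p ≡ y →
               accepts patternM k p ≡ accepts patternN k (swapShapes p)
    by-cases false im x fm y fn = begin
      accepts patternM k p              ≡⟨ accepts-≡ patternM k p im refl refl ⟩
      false                             ≡⟨ accepts-≡ patternN k p im refl refl ⟨
      accepts patternN k p              ≡⟨ cong (accepts patternN k) (swapShapes-≡ p im fm fn) ⟨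
      accepts patternN k (swapShapes p) ∎
      where open ≡-Reasoning
    by-cases true im (just t) fm y fn = begin
      accepts patternM k p              ≡⟨ accepts-≡ patternM k p im refl (lastThreeForm-found p (patternM p) fm) ⟩
      (crossings p ≡ᵇ k) ∧ true         ≡⟨ accepts-≡ patternN k q (image-isMatching exchanges) crossings-exchangeAt
                                             (lastThreeForm-found q (patternN q) (proj₁ (proj₂ (returns exchanges)))) ⟨
      accepts patternN k q              ≡⟨ cong (accepts patternN k) (swapShapes-≡ p im fm fn) ⟨
      accepts patternN k (swapShapes p) ∎
      where
      open ≡-Reasoning
      open ExchangeFound p im fm
      open Exchanges
      q = exchangeAt p (toℕ³ t)
    by-cases true im nothing fm (just t) fn = begin
      accepts patternM k p              ≡⟨ accepts-≡ patternM k p im refl (lastThreeForm-notFound p (patternM p) fm) ⟩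
      (crossings p ≡ᵇ k) ∧ false        ≡⟨ ∧-zeroʳ (crossings p ≡ᵇ k) ⟩
      false                             ≡⟨ ∧-zeroʳ (crossings r ≡ᵇ k) ⟨
      (crossings r ≡ᵇ k) ∧ false        ≡⟨ accepts-≡ patternN k r (image-isMatching unexchanges) refl (lastThreeForm-notFound r (patternN r) (leaves unexchanges)) ⟨
      accepts patternN k r              ≡⟨ cong (accepts patternN k) (swapShapes-≡ p im fm fn) ⟨
      accepts patternN k (swapShapes p) ∎
      where
      open ≡-Reasoning
      open UnexchangeFound p im fn
      open Exchanges
      r = unexchangeAt p (toℕ³ t)
    by-cases true im nothing fm nothing fn = begin
      accepts patternM k p              ≡⟨ accepts-≡ patternM k p im refl (lastThreeForm-notFound p (patternM p) fm) ⟩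
      (crossings p ≡ᵇ k) ∧ false        ≡⟨ accepts-≡ patternN k p im refl (lastThreeForm-notFound p (patternN p) fn) ⟨
      accepts patternN k p              ≡⟨ cong (accepts patternN k) (swapShapes-≡ p im fm fn) ⟨
      accepts patternN k (swapShapes p) ∎
      where open ≡-Reasoning

open VectorEncoding using (count-involution; allVecs-unique; allVecs-complete)
open SwapShapes using (swapShapes; swapShapes-involutive; accepts-swapShapes)

corollary1p6 : (k n : ℕ) → countM k n ≡ countN k n
corollary1p6 k n = count-involution (allVecs (2 * n) (2 * n)) (allVecs-unique _ _) (allVecs-complete _ _)
                     swapShapes swapShapes-involutive _ _ (accepts-swapShapes k)
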